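{- Let $p\geq 3$ be odd and let $G=(V,E)$ be a $(p,2)$-flex-connected graph. Let $\mathcal{F}_1$ be the family of violated sets $A\subseteq V$ such that either (i) $A$ crosses no violated set, or (ii) $A$ amenably crosses some violated set. Then $\mathcal{F}_1$ is an uncrossable family.
   Context: $G=(V,E)$ is a finite graph (parallel edges allowed) whose edge set is partitioned into safe and unsafe edges; $\mathcal{U}$ is the set of unsafe edges. For $S\subseteq V$, $\delta(S)$ is the set of edges with exactly one endpoint in $S$; for disjoint $X,Y\subseteq V$, $E(X,Y)$ is the set of edges with one endpoint in $X$ and the other in $Y$. $G$ is $(p,2)$-flex-connected if for every $F\subseteq\mathcal{U}$ with $|F|\leq 2$ the graph $(V,E\setminus F)$ is $p$-edge-connected. A set $S\subseteq V$ is violated if $|\delta(S)|=p+2$ and $\delta(S)$ contains at least $3$ unsafe edges. Two sets $A,B\subseteq V$ cross if $A\setminus B$, $A\cap B$, $B\setminus A$, $V\setminus(A\cup B)$ are all nonempty. $A$ amenably crosses $B$ if $A$ crosses $B$ and at least one of the edge sets $E(A\cap B, B\setminus A)$ and $E(A\setminus B, V\setminus(A\cup B))$ contains no unsafe edge. A family $\mathcal{H}\subseteq 2^V$ is uncrossable if for all $A,B\in\mathcal{H}$, either ($A\cup B\in\mathcal{H}$ and $A\cap B\in\mathcal{H}$) or ($A\setminus B\in\mathcal{H}$ and $B\setminus A\in\mathcal{H}$). -}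

module Defs where

open import Data.Nat using (ℕ; _≤_; _+_)
open import Data.Bool using (Bool; true; false; _∧_; _∨_; _xor_; not)
open import Data.Fin using (Fin)
open import Data.Fin.Subset using (Subset; _∈_; _∉_; _⊆_; _∩_; _∪_; _─_; ∁; ∣_∣; Nonempty)
open import Data.Vec using (lookup; tabulate)
open import Data.Product using (_×_; Σ; ∃-syntax)
open import Data.Sum using (_⊎_)
open import Relation.Binary.PropositionalEquality using (_≡_)
open import Relation.Nullary using (¬_)

-- A finite multigraph with vertex set Fin n and edge set Fin m
-- (parallel edges allowed: distinct edge indices may have the same ends),
-- together with the set of unsafe edges.
record Graph (n m : ℕ) : Set where
  field
    ends   : Fin m → Fin n × Fin n
    unsafe : Subset m

module _ {n m : ℕ} (G : Graph n m) where
  open Graph G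

  private
    endˡ endʳ : Fin m → Fin n
    endˡ e = Data.Product.proj₁ (ends e)
    endʳ e = Data.Product.proj₂ (ends e)

  δ : Subset n → Subset m
  δ S = tabulate (λ e → lookup S (endˡ e) xor lookup S (endʳ e))

  Eb : Subset n → Subset n → Subset m
  Eb X Y = tabulate (λ e → (lookup X (endˡ e) ∧ lookup Y (endʳ e))
                          ∨ (lookup Y (endˡ e) ∧ lookup X (endʳ e)))

  EdgeConnectedWithout : ℕ → Subset m → Set
  EdgeConnectedWithout p F =
    ∀ (S : Subset n) → Nonempty S → Nonempty (∁ S) → p ≤ ∣ δ S ∩ ∁ F ∣

  FlexConnected : ℕ → Set
  FlexConnected p = ∀ (F : Subset m) → F ⊆ unsafe → ∣ F ∣ ≤ 2 →
                    EdgeConnectedWithout p F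

  Violated : ℕ → Subset n → Set
  Violated p S = (∣ δ S ∣ ≡ p + 2) × (3 ≤ ∣ δ S ∩ unsafe ∣)

  Cross : Subset n → Subset n → Set
  Cross A B = Nonempty (A ─ B) × Nonempty (A ∩ B) × Nonempty (B ─ A)
              × Nonempty (∁ (A ∪ B))

  NoUnsafeEdge : Subset m → Set
  NoUnsafeEdge D = ∀ e → e ∈ D → e ∉ unsafe

  AmenablyCross : Subset n → Subset n → Set
  AmenablyCross A B = Cross A B ×
    (NoUnsafeEdge (Eb (A ∩ B) (B ─ A)) ⊎ NoUnsafeEdge (Eb (A ─ B) (∁ (A ∪ B))))

  F₁ : ℕ → Subset n → Set
  F₁ p A = Violated p A ×
    ((∀ B → Violated p B → ¬ Cross A B)
     ⊎ (∃[ B ] (Violated p B × AmenablyCross A B)))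

Uncrossable : {n : ℕ} → (Subset n → Set) → Set
Uncrossable {n} H = ∀ (A B : Subset n) → H A → H B →
  (H (A ∪ B) × H (A ∩ B)) ⊎ (H (A ─ B) × H (B ─ A))

-- Write p = 2k + 1 and let d(S), u(S) count the edges and unsafe edges of δ(S).
-- Flex-connectivity gives d(S) ≥ p + min(2, u(S)) for every nonempty proper S.
-- For crossing violated X and Y, the identities d(X∩Y) + d(X∪Y) + 2|E(X─Y, Y─X)| =
-- d(X) + d(Y) = 2(p + 2) and its mirror image then leave no room for "diagonal" edges
-- (one would make d(X∩Y) both even and odd), and every half of δ(X) cut out by Y has
-- at least k + 1 edges.  Call A amenable if it is violated and amenably crosses every
-- violated set it crosses.  If A amenably crosses one violated C, through the safe half
-- K = E(A∩C, C─A), it amenably crosses every violated B it crosses: otherwise both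
-- halves of δ(A) cut out by B contain unsafe edges, and either K fits inside one of
-- them, which is then too large, or all eight atoms of the Venn diagram of A, B, C
-- have nonempty cuts, whose flex bounds add up to more than 2(d(A) + d(B) + d(C)).
-- So F₁ is the family of amenable sets.  It is closed under complement, and for
-- crossing A, B the safe halves single out two opposite quadrants that are tight,
-- hence violated, and whose unsafe boundary lies in the boundary of A, B or their
-- complements; this makes them amenable as well.

module Submission where

open import Data.Bool using (Bool; true; false; _∧_; _∨_; _xor_; not; T)
open import Data.Bool.Properties using (not-involutive; ∧-zeroʳ; ∧-identityʳ)
open import Data.Empty using (⊥; ⊥-elim)
open import Data.Fin using (Fin; zero; suc)
open import Data.Fin.Subset using (Subset; _∈_; _⊆_; _∩_; _∪_; _─_; ∁; ∣_∣; Nonempty)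
open import Data.Fin.Subset.Properties using (nonempty?; anySubset?; drop-∷-⊆; x∈p∩q⁺; x∈p∩q⁻)
open import Data.Nat using (ℕ; zero; suc; _+_; _*_; _⊓_; _≤_; _%_; _/_; z≤n; s≤s; _≟_; _≤?_; _≡ᵇ_; _≤ᵇ_)
open import Data.Nat.DivMod using (m≡m%n+[m/n]*n)
open import Data.Nat.Properties
open import Algebra.Properties.CommutativeSemigroup +-commutativeSemigroup
  using () renaming (interchange to +-interchange)
open import Data.Nat.Tactic.RingSolver using (solve-∀)
open import Data.Product using (_×_; _,_; proj₁; proj₂; ∃)
open import Data.Sum using (_⊎_; inj₁; inj₂)
open import Data.Unit using (tt)
open import Data.Vec using ([]; _∷_; lookup; tabulate; here; there)
open import Data.Vec.Properties
  using (lookup-map; lookup-zipWith; lookup∘tabulate; tabulate∘lookup; tabulate-cong; map-∘; map-cong; map-id;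
         []=⇒lookup; lookup⇒[]=)
open import Function using (_∘_; _$_)
open import Relation.Binary.PropositionalEquality
open import Relation.Nullary using (Dec; yes; no; ¬_; contradiction)
open import Relation.Nullary.Decidable using (_×-dec_)

open import Defs

𝟙 : Bool → ℕ
𝟙 true  = 1
𝟙 false = 0

∑ : ∀ {m} → (Fin m → ℕ) → ℕ
∑ {zero}  f = 0
∑ {suc m} f = f zero + ∑ (f ∘ suc)

∑-cong : ∀ {m} {f g : Fin m → ℕ} → (∀ i → f i ≡ g i) → ∑ f ≡ ∑ g
∑-cong {zero}  eq = refl
∑-cong {suc m} eq = cong₂ _+_ (eq zero) (∑-cong (eq ∘ suc))

∑-mono-≤ : ∀ {m} {f g : Fin m → ℕ} → (∀ i → f i ≤ g i) → ∑ f ≤ ∑ g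
∑-mono-≤ {zero}  le = z≤n
∑-mono-≤ {suc m} le = +-mono-≤ (le zero) (∑-mono-≤ (le ∘ suc))

∑-distrib-+ : ∀ {m} (f g : Fin m → ℕ) → ∑ (λ i → f i + g i) ≡ ∑ f + ∑ g
∑-distrib-+ {zero}  f g = refl
∑-distrib-+ {suc m} f g = begin
  (f zero + g zero) + ∑ (λ i → f (suc i) + g (suc i))
    ≡⟨ cong (f zero + g zero +_) (∑-distrib-+ (f ∘ suc) (g ∘ suc)) ⟩
  (f zero + g zero) + (∑ (f ∘ suc) + ∑ (g ∘ suc))
    ≡⟨ +-interchange (f zero) (g zero) _ _ ⟩
  (f zero + ∑ (f ∘ suc)) + (g zero + ∑ (g ∘ suc)) ∎
  where open ≡-Reasoning

∑-zero : ∀ m → ∑ {m} (λ _ → 0) ≡ 0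
∑-zero zero    = refl
∑-zero (suc m) = ∑-zero m

term≤∑ : ∀ {m} (f : Fin m → ℕ) i → f i ≤ ∑ f
term≤∑ f zero    = m≤m+n (f zero) _
term≤∑ f (suc i) = ≤-trans (term≤∑ (f ∘ suc) i) (m≤n+m _ (f zero))

∑≡0⇒term≡0 : ∀ {m} (f : Fin m → ℕ) → ∑ f ≡ 0 → ∀ i → f i ≡ 0
∑≡0⇒term≡0 f eq i = n≤0⇒n≡0 (subst (f i ≤_) eq (term≤∑ f i))

∑-positive : ∀ {m} (f : Fin m → ℕ) → 1 ≤ ∑ f → ∃ λ i → 1 ≤ f i
∑-positive {zero}  f ()
∑-positive {suc m} f pos with f zero in eq
... | suc _ = zero , subst (1 ≤_) (sym eq) (s≤s z≤n)
... | zero  = let i , fi = ∑-positive (f ∘ suc) pos in suc i , fi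

∣∣≡∑𝟙 : ∀ {m} (xs : Subset m) → ∣ xs ∣ ≡ ∑ (𝟙 ∘ lookup xs)
∣∣≡∑𝟙 []           = refl
∣∣≡∑𝟙 (true ∷ xs)  = cong suc (∣∣≡∑𝟙 xs)
∣∣≡∑𝟙 (false ∷ xs) = ∣∣≡∑𝟙 xs

lookup-─ : ∀ {m} (xs ys : Subset m) i → lookup (xs ─ ys) i ≡ (lookup xs i ∧ not (lookup ys i))
lookup-─ (x ∷ xs) (true  ∷ ys) zero    = sym (∧-zeroʳ x)
lookup-─ (x ∷ xs) (false ∷ ys) zero    = sym (∧-identityʳ x)
lookup-─ (x ∷ xs) (y ∷ ys)     (suc i) = lookup-─ xs ys i

𝟙≡0⇒≡false : ∀ {b} → 𝟙 b ≡ 0 → b ≡ false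
𝟙≡0⇒≡false {false} _ = refl

𝟙∧≡0 : ∀ a b → (a ≡ true → b ≡ true → ⊥) → 𝟙 (a ∧ b) ≡ 0
𝟙∧≡0 true  true  ¬both = ⊥-elim (¬both refl refl)
𝟙∧≡0 true  false _     = refl
𝟙∧≡0 false b     _     = refl

𝟙∧≤𝟙 : ∀ a b → 𝟙 (a ∧ b) ≤ 𝟙 a
𝟙∧≤𝟙 true  true  = ≤-refl
𝟙∧≤𝟙 true  false = z≤n
𝟙∧≤𝟙 false b     = z≤n

∈⇒lookup : ∀ {m} {i : Fin m} {xs : Subset m} → i ∈ xs → lookup xs i ≡ true
∈⇒lookup = []=⇒lookup

lookup⇒∈ : ∀ {m} {i : Fin m} {xs : Subset m} → lookup xs i ≡ true → i ∈ xs
lookup⇒∈ {i = i} {xs} = lookup⇒[]= i xs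

∧≡true : ∀ {a b} → (a ∧ b) ≡ true → a ≡ true × b ≡ true
∧≡true {true} {true} _ = refl , refl

not≡true : ∀ {b} → not b ≡ true → b ≡ false
not≡true {false} _ = refl

¬Nonempty⇒lookup≡false : ∀ {m} (S : Subset m) → ¬ Nonempty S → ∀ i → lookup S i ≡ false
¬Nonempty⇒lookup≡false S empty i with lookup S i in eq
... | true  = ⊥-elim (empty (i , lookup⇒∈ eq))
... | false = refl

─-monoˡ : ∀ {m} {p q : Subset m} (r : Subset m) → p ⊆ q → p ─ r ⊆ q ─ r
─-monoˡ {p = p} {q} r p⊆q {v} v∈p─r with ∧≡true (trans (sym (lookup-─ p r v)) (∈⇒lookup v∈p─r))
... | v∈p , v∉r = lookup⇒∈ (trans (lookup-─ q r v) (cong₂ _∧_ (∈⇒lookup (p⊆q (lookup⇒∈ v∈p))) v∉r))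

∩-monoˡ : ∀ {m} {p q : Subset m} (r : Subset m) → p ⊆ q → p ∩ r ⊆ q ∩ r
∩-monoˡ {p = p} r p⊆q v∈p∩r with x∈p∩q⁻ p r v∈p∩r
... | v∈p , v∈r = x∈p∩q⁺ (p⊆q v∈p , v∈r)

Subset-ext : ∀ {m} {xs ys : Subset m} → (∀ i → lookup xs i ≡ lookup ys i) → xs ≡ ys
Subset-ext {xs = xs} {ys} eq =
  trans (sym (tabulate∘lookup xs)) (trans (tabulate-cong eq) (tabulate∘lookup ys))

∁-involutive : ∀ {m} (S : Subset m) → ∁ (∁ S) ≡ S
∁-involutive S = trans (sym (map-∘ not not S)) (trans (map-cong not-involutive S) (map-id S))

∣p∣≡∣p∩∁q∣+∣q∣ : ∀ {m} {p q : Subset m} → q ⊆ p → ∣ p ∣ ≡ ∣ p ∩ ∁ q ∣ + ∣ q ∣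
∣p∣≡∣p∩∁q∣+∣q∣ {p = []}         {[]}         q⊆p = refl
∣p∣≡∣p∩∁q∣+∣q∣ {p = x ∷ p}      {true ∷ q}   q⊆p with q⊆p here
... | here = trans (cong suc (∣p∣≡∣p∩∁q∣+∣q∣ (drop-∷-⊆ q⊆p))) (sym (+-suc _ _))
∣p∣≡∣p∩∁q∣+∣q∣ {p = true ∷ p}   {false ∷ q}  q⊆p = cong suc (∣p∣≡∣p∩∁q∣+∣q∣ (drop-∷-⊆ q⊆p))
∣p∣≡∣p∩∁q∣+∣q∣ {p = false ∷ p}  {false ∷ q}  q⊆p = ∣p∣≡∣p∩∁q∣+∣q∣ (drop-∷-⊆ q⊆p)

takeTrue : ∀ {m} → ℕ → Subset m → Subset m
takeTrue k       []           = []
takeTrue zero    (x ∷ xs)     = false ∷ takeTrue zero xs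
takeTrue (suc k) (true ∷ xs)  = true ∷ takeTrue k xs
takeTrue (suc k) (false ∷ xs) = false ∷ takeTrue (suc k) xs

takeTrue-⊆ : ∀ {m} k (xs : Subset m) → takeTrue k xs ⊆ xs
takeTrue-⊆ zero    (x ∷ xs)     (there i∈) = there (takeTrue-⊆ zero xs i∈)
takeTrue-⊆ (suc k) (true ∷ xs)  here       = here
takeTrue-⊆ (suc k) (true ∷ xs)  (there i∈) = there (takeTrue-⊆ k xs i∈)
takeTrue-⊆ (suc k) (false ∷ xs) (there i∈) = there (takeTrue-⊆ (suc k) xs i∈)

∣takeTrue∣ : ∀ {m} k (xs : Subset m) → ∣ takeTrue k xs ∣ ≡ ∣ xs ∣ ⊓ k
∣takeTrue∣ zero    []           = refl
∣takeTrue∣ (suc k) []           = refl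
∣takeTrue∣ zero    (x ∷ xs)     = trans (∣takeTrue∣ zero xs) (trans (⊓-zeroʳ ∣ xs ∣) (sym (⊓-zeroʳ ∣ x ∷ xs ∣)))
∣takeTrue∣ (suc k) (true ∷ xs)  = cong suc (∣takeTrue∣ k xs)
∣takeTrue∣ (suc k) (false ∷ xs) = ∣takeTrue∣ (suc k) xs

cap₂ : ℕ → ℕ
cap₂ zero          = 0
cap₂ (suc zero)    = 1
cap₂ (suc (suc _)) = 2

⊓2≡cap₂ : ∀ u → u ⊓ 2 ≡ cap₂ u
⊓2≡cap₂ zero          = refl
⊓2≡cap₂ (suc zero)    = refl
⊓2≡cap₂ (suc (suc u)) = cong (2 +_) (⊓-zeroʳ u)

cap₂≤2 : ∀ u → cap₂ u ≤ 2
cap₂≤2 zero          = z≤n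
cap₂≤2 (suc zero)    = s≤s z≤n
cap₂≤2 (suc (suc _)) = ≤-refl

cap₂≡0 : ∀ {u} → cap₂ u ≤ 0 → u ≡ 0
cap₂≡0 {zero} _ = refl
cap₂≡0 {suc zero} ()
cap₂≡0 {suc (suc _)} ()

cap₂≤1 : ∀ {u} → cap₂ u ≤ 1 → u ≤ 1
cap₂≤1 {zero}       _ = z≤n
cap₂≤1 {suc zero}   _ = ≤-refl
cap₂≤1 {suc (suc _)} (s≤s ())

cap₂≡2 : ∀ {u} → 2 ≤ u → cap₂ u ≡ 2
cap₂≡2 {suc (suc _)} _ = refl
cap₂≡2 {suc zero} (s≤s ())

cap₂-positive : ∀ {u} → 1 ≤ u → 1 ≤ cap₂ u
cap₂-positive {suc zero}    _ = ≤-refl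
cap₂-positive {suc (suc _)} _ = s≤s z≤n

cap₂-mono-≤ : ∀ {a b} → a ≤ b → cap₂ a ≤ cap₂ b
cap₂-mono-≤ {zero}                        _ = z≤n
cap₂-mono-≤ {suc zero}    {suc zero}      _ = ≤-refl
cap₂-mono-≤ {suc zero}    {suc (suc _)}   _ = s≤s z≤n
cap₂-mono-≤ {suc (suc _)} {suc (suc _)}   _ = ≤-refl
cap₂-mono-≤ {suc (suc _)} {suc zero} (s≤s ())

cap₂-subadditive : ∀ a b → cap₂ (a + b) ≤ cap₂ a + cap₂ b
cap₂-subadditive zero          b = ≤-refl
cap₂-subadditive (suc zero)    zero = ≤-refl
cap₂-subadditive (suc zero)    (suc b) = ≤-trans (cap₂≤2 (suc (suc b))) (s≤s (cap₂-positive (s≤s z≤n)))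
cap₂-subadditive (suc (suc a)) b = m≤m+n 2 (cap₂ b)

cap₂-pair : ∀ {a b} → 3 ≤ a + b → 2 ≤ cap₂ a + cap₂ b
cap₂-pair {a} {b} a+b≥3 =
  subst (_≤ cap₂ a + cap₂ b) (cap₂≡2 (≤-trans (s≤s (s≤s z≤n)) a+b≥3)) (cap₂-subadditive a b)

odd≢even : ∀ a b → suc (a + a) ≢ b + b
odd≢even zero    zero    ()
odd≢even zero    (suc b) eq = 0≢1+n (trans (suc-injective eq) (+-suc b b))
odd≢even (suc a) zero    ()
odd≢even (suc a) (suc b) eq =
  odd≢even a b (suc-injective (trans (cong suc (sym (+-suc a a))) (trans (suc-injective eq) (+-suc b b))))

half-≤ : ∀ a e → a + a ≤ suc (e + e) → a ≤ e
half-≤ zero    e       _  = z≤n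
half-≤ (suc a) zero    (s≤s le) rewrite +-suc a a = contradiction le λ ()
half-≤ (suc a) (suc e) (s≤s le) rewrite +-suc a a | +-suc e e = s≤s (half-≤ a e (≤-pred le))

squeeze : ∀ q {a b c} → a + b + (c + c) ≡ q + q → q ≤ a → q ≤ b → a ≡ q × b ≡ q
squeeze q {a} {b} {c} sum q≤a q≤b = ≤-antisym a≤q q≤a , ≤-antisym b≤q q≤b
  where
  a+b≤q+q : a + b ≤ q + q
  a+b≤q+q = subst (a + b ≤_) sum (m≤m+n (a + b) (c + c))
  a≤q : a ≤ q
  a≤q = +-cancelʳ-≤ q a q (≤-trans (+-monoʳ-≤ a q≤b) a+b≤q+q)
  b≤q : b ≤ q
  b≤q = +-cancelˡ-≤ q b q (≤-trans (+-monoˡ-≤ b q≤a) a+b≤q+q)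

≤-drop-zero : ∀ {a b c} → a ≤ b + c → c ≡ 0 → a ≤ b
≤-drop-zero {b = b} a≤b+c refl = subst (_ ≤_) (+-identityʳ b) a≤b+c

split-≤ : ∀ p {c d} → p + c ≤ d → ∃ λ x → d ≡ p + x × c ≤ x
split-≤ p {c} le with m≤n⇒∃[o]m+o≡n le
... | o , eq = c + o , trans (sym eq) (+-assoc p c o) , m≤m+n c o

6≰4 : ¬ 6 ≤ 4
6≰4 (s≤s (s≤s (s≤s (s≤s ()))))

excess-cases : ∀ {x₁ x₄ D U u₁ u₄} → x₁ + x₄ + D ≡ 4 → x₁ + x₄ ≤ 2 → U ≤ D →
               cap₂ u₁ ≤ x₁ → cap₂ u₄ ≤ x₄ → 6 ≤ u₁ + u₄ + U →
               (u₄ ≡ 0 × x₁ ≡ 2) ⊎ (u₁ ≡ 0 × x₁ ≡ 0)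
excess-cases {0} {0} refl _ U≤4 c₁ c₄ six
  rewrite cap₂≡0 c₁ | cap₂≡0 c₄ = ⊥-elim (6≰4 (≤-trans six U≤4))
excess-cases {0} {1} refl _ _ c₁ _ _ = inj₂ (cap₂≡0 c₁ , refl)
excess-cases {0} {2} refl _ _ c₁ _ _ = inj₂ (cap₂≡0 c₁ , refl)
excess-cases {1} {0} refl _ U≤3 c₁ c₄ six
  rewrite cap₂≡0 c₄ = ⊥-elim (6≰4 (≤-trans six (+-mono-≤ (+-monoˡ-≤ 0 (cap₂≤1 c₁)) U≤3)))
excess-cases {1} {1} refl _ U≤2 c₁ c₄ six =
  ⊥-elim (6≰4 (≤-trans six (+-mono-≤ (+-mono-≤ (cap₂≤1 c₁) (cap₂≤1 c₄)) U≤2)))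
excess-cases {2} {0} refl _ _ _ c₄ _ = inj₁ (cap₂≡0 c₄ , refl)
excess-cases {0} {suc (suc (suc _))} _ (s≤s (s≤s ()))
excess-cases {1} {suc (suc _)} _ (s≤s (s≤s ()))
excess-cases {2} {suc _} _ (s≤s (s≤s ()))
excess-cases {suc (suc (suc _))} _ (s≤s (s≤s ()))

excess-equation : ∀ p {x₁ x₄ D} → (p + x₁) + (p + x₄) + D ≡ (p + 2) + (p + 2) → x₁ + x₄ + D ≡ 4
excess-equation p {x₁} {x₄} {D} sum =
  +-cancelˡ-≡ (p + p) _ _ (trans (rearrange p x₁ x₄ D) (trans sum (four p)))
  where
  rearrange : ∀ p a b c → p + p + (a + b + c) ≡ (p + a) + (p + b) + c
  rearrange = solve-∀
  four : ∀ p → (p + 2) + (p + 2) ≡ p + p + 4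
  four = solve-∀

excess≤2 : ∀ {a D} → a + D ≡ 4 → 2 ≤ D → a ≤ 2
excess≤2 {a} eq 2≤D = +-cancelʳ-≤ 2 a 2 (subst (a + 2 ≤_) eq (+-monoʳ-≤ a 2≤D))

diagonal-cases : ∀ p {d₁ d₄ u₁ u₄ E uE} → 1 ≤ E →
  d₁ + d₄ + (E + E) ≡ (p + 2) + (p + 2) → p + cap₂ u₁ ≤ d₁ → p + cap₂ u₄ ≤ d₄ →
  uE ≤ E → 6 ≤ u₁ + u₄ + (uE + uE) → (u₄ ≡ 0 × d₁ ≡ p + 2) ⊎ (u₁ ≡ 0 × d₁ ≡ p)
diagonal-cases p E≥1 sum flex₁ flex₄ uE≤E six
  with split-≤ p flex₁ | split-≤ p flex₄
... | x₁ , refl , c₁ | x₄ , refl , c₄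
  with excess-cases excess (excess≤2 excess (+-mono-≤ E≥1 E≥1)) (+-mono-≤ uE≤E uE≤E) c₁ c₄ six
  where excess = excess-equation p sum
... | inj₁ (u₄≡0 , refl) = inj₁ (u₄≡0 , refl)
... | inj₂ (u₁≡0 , refl) = inj₂ (u₁≡0 , +-identityʳ p)

link-lower-bound : ∀ k j {d₁ d₃ c₁ c₃ e} → let p = suc (k + k) in
  d₁ + d₃ ≡ (p + 2) + (e + e) → p + c₁ ≤ d₁ → p + c₃ ≤ d₃ → j + j ≤ c₁ + c₃ → j + k ≤ e
link-lower-bound k j {d₁} {d₃} {c₁} {c₃} {e} sum flex₁ flex₃ caps =
  half-≤ (j + k) e (+-cancelˡ-≤ p _ _ (≤-pred (begin
    suc (p + ((j + k) + (j + k)))  ≡⟨ lhs k j ⟩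
    p + p + (j + j)                 ≤⟨ +-monoʳ-≤ (p + p) caps ⟩
    p + p + (c₁ + c₃)               ≡⟨ +-interchange p p c₁ c₃ ⟩
    (p + c₁) + (p + c₃)             ≤⟨ +-mono-≤ flex₁ flex₃ ⟩
    d₁ + d₃                         ≡⟨ sum ⟩
    (p + 2) + (e + e)               ≡⟨ rhs k e ⟩
    suc (p + suc (e + e))           ∎)))
  where
  open ≤-Reasoning
  p = suc (k + k)
  lhs : ∀ k j → suc (suc (k + k) + ((j + k) + (j + k))) ≡ suc (k + k) + suc (k + k) + (j + j)
  lhs = solve-∀
  rhs : ∀ k e → (suc (k + k) + 2) + (e + e) ≡ suc (suc (k + k) + suc (e + e))
  rhs = solve-∀

link-split-absurd : ∀ k {h₁ h₂ K x y} → h₁ + h₂ ≡ suc (k + k) + 2 →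
  suc k ≤ K → K + x ≤ h₁ → 1 ≤ x → suc k ≤ h₂ → 3 ≤ x + y → (2 ≤ y → 2 + k ≤ h₂) → ⊥
link-split-absurd k {h₁} {h₂} {K} {x} {y} sum K≥ K+x≤h₁ x≥1 h₂≥ x+y≥3 y≥2⇒h₂≥ =
  <-irrefl refl (subst (_≤ suc (k + k) + 2) (too-many k)
    (≤-trans (+-mono-≤ (+-monoʳ-≤ (suc k) x≥1) (y≥2⇒h₂≥ y≥2)) (at-most ≤-refl)))
  where
  too-many : ∀ k → suc k + 1 + (2 + k) ≡ suc (suc (k + k) + 2)
  too-many = solve-∀
  at-most : ∀ {h} → h ≤ h₂ → suc k + x + h ≤ suc (k + k) + 2
  at-most {h} h≤h₂ = subst (suc k + x + h ≤_) sum (+-mono-≤ (≤-trans (+-monoˡ-≤ x K≥) K+x≤h₁) h≤h₂)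
  x≤1 : x ≤ 1
  x≤1 = +-cancelˡ-≤ (suc k + suc k) x 1 (subst₂ _≤_ (e₁ k x) (e₂ k) (at-most h₂≥))
    where
    e₁ : ∀ k x → suc k + x + suc k ≡ suc k + suc k + x
    e₁ = solve-∀
    e₂ : ∀ k → suc (k + k) + 2 ≡ suc k + suc k + 1
    e₂ = solve-∀
  y≥2 : 2 ≤ y
  y≥2 = +-cancelˡ-≤ 1 2 y (≤-trans x+y≥3 (+-monoˡ-≤ y x≤1))

flex-sum₄ : ∀ p {d₁ d₂ d₃ d₄ c₁ c₂ c₃ c₄} → p + c₁ ≤ d₁ → p + c₂ ≤ d₂ → p + c₃ ≤ d₃ → p + c₄ ≤ d₄ →
            4 * p + (c₁ + c₂ + c₃ + c₄) ≤ d₁ + d₂ + d₃ + d₄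
flex-sum₄ p {d₁} {d₂} {d₃} {d₄} {c₁} {c₂} {c₃} {c₄} f₁ f₂ f₃ f₄ =
  subst (_≤ d₁ + d₂ + d₃ + d₄) (regroup p c₁ c₂ c₃ c₄) (+-mono-≤ (+-mono-≤ (+-mono-≤ f₁ f₂) f₃) f₄)
  where
  regroup : ∀ p c₁ c₂ c₃ c₄ → (p + c₁) + (p + c₂) + (p + c₃) + (p + c₄) ≡ 4 * p + (c₁ + c₂ + c₃ + c₄)
  regroup = solve-∀

cap₂-sum₄ : ∀ a b c d → 1 ≤ a + b + c + d → 1 ≤ cap₂ a + cap₂ b + cap₂ c + cap₂ d
cap₂-sum₄ a b c d pos = ≤-trans (cap₂-positive pos)
  (≤-trans (cap₂-subadditive (a + b + c) d) (+-monoˡ-≤ (cap₂ d)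
    (≤-trans (cap₂-subadditive (a + b) c) (+-monoˡ-≤ (cap₂ c) (cap₂-subadditive a b)))))

cap₂-sum₄-≥ : ∀ {i j x y a b c d} → i ≤ x → j ≤ y → x ≤ a → x ≤ b → y ≤ c → y ≤ d →
              cap₂ i + cap₂ i + cap₂ j + cap₂ j ≤ cap₂ a + cap₂ b + cap₂ c + cap₂ d
cap₂-sum₄-≥ i≤x j≤y x≤a x≤b y≤c y≤d =
  +-mono-≤ (+-mono-≤ (+-mono-≤ (cap₂-mono-≤ (≤-trans i≤x x≤a)) (cap₂-mono-≤ (≤-trans i≤x x≤b)))
                     (cap₂-mono-≤ (≤-trans j≤y y≤c)))
           (cap₂-mono-≤ (≤-trans j≤y y≤d))

cap₂-sum₄-six : ∀ {x y a b c d} → 1 ≤ x → 1 ≤ y → 3 ≤ x + y → x ≤ a → x ≤ b → y ≤ c → y ≤ d →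
                6 ≤ cap₂ a + cap₂ b + cap₂ c + cap₂ d
cap₂-sum₄-six {x} {y} x≥1 y≥1 x+y≥3 x≤a x≤b y≤c y≤d with 2 ≤? x
... | yes x≥2 = cap₂-sum₄-≥ x≥2 y≥1 x≤a x≤b y≤c y≤d
... | no x≱2  = cap₂-sum₄-≥ x≥1 y≥2 x≤a x≤b y≤c y≤d
  where
  y≥2 : 2 ≤ y
  y≥2 = +-cancelˡ-≤ 1 2 y (≤-trans x+y≥3 (+-monoˡ-≤ y (≤-pred (≰⇒> x≱2))))

cube-absurd : ∀ p {S₁ S₂} → 3 ≤ p → 4 * p + 6 ≤ S₁ → 4 * p + 1 ≤ S₂ → S₁ + S₂ ≤ 6 * (p + 2) → ⊥
cube-absurd p {S₁} {S₂} p≥3 lower₁ lower₂ upper =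
  <-irrefl refl (≤-trans (+-monoˡ-≤ 7 (*-monoʳ-≤ 2 p≥3)) (+-cancelˡ-≤ (6 * p) _ _ (begin
    6 * p + (2 * p + 7)          ≡⟨ regroup p ⟩
    (4 * p + 6) + (4 * p + 1)    ≤⟨ +-mono-≤ lower₁ lower₂ ⟩
    S₁ + S₂                      ≤⟨ upper ⟩
    6 * (p + 2)                  ≡⟨ *-distribˡ-+ 6 p 2 ⟩
    6 * p + 12                   ∎)))
  where
  open ≤-Reasoning
  regroup : ∀ p → 6 * p + (2 * p + 7) ≡ (4 * p + 6) + (4 * p + 1)
  regroup = solve-∀

-- A vertex is classified by its membership in three sets X, Y, W, an edge by the
-- regions of its ends and by being unsafe.  The counts below are sums over edges of
-- functions of this type, so linear relations between them are checked by evaluation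
-- on all 2⁷ edge types.
Region : Set
Region = Bool × Bool × Bool

EdgeWeight : Set
EdgeWeight = Region → Region → Bool → ℕ

every : (Bool → Bool) → Bool
every f = f true ∧ f false

every-sound : ∀ f → T (every f) → ∀ b → T (f b)
every-sound f ok true  with f true | f false
... | true | true = tt
every-sound f ok false with f true | f false
... | true | true = tt

everyRegion : (Region → Bool) → Bool
everyRegion f = every λ a → every λ b → every λ c → f (a , b , c)

everyRegion-sound : ∀ f → T (everyRegion f) → ∀ x → T (f x)
everyRegion-sound f ok (a , b , c) =
  every-sound (λ c → f (a , b , c))
    (every-sound (λ b → every λ c → f (a , b , c))
      (every-sound (λ a → every λ b → every λ c → f (a , b , c)) ok a) b) c

everyEdgeType : (Region → Region → Bool → Bool) → Bool
everyEdgeType f = everyRegion λ x → everyRegion λ y → every (f x y)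

everyEdgeType-sound : ∀ f → T (everyEdgeType f) → ∀ x y u → T (f x y u)
everyEdgeType-sound f ok x y =
  every-sound (f x y)
    (everyRegion-sound (λ y → every (f x y))
      (everyRegion-sound (λ x → everyRegion λ y → every (f x y)) ok x) y)

weights-≡ : (g h : EdgeWeight) → T (everyEdgeType λ x y u → g x y u ≡ᵇ h x y u) →
            ∀ x y u → g x y u ≡ h x y u
weights-≡ g h ok x y u =
  ≡ᵇ⇒≡ _ _ (everyEdgeType-sound (λ x y u → g x y u ≡ᵇ h x y u) ok x y u)

weights-≤ : (g h : EdgeWeight) → T (everyEdgeType λ x y u → g x y u ≤ᵇ h x y u) →
            ∀ x y u → g x y u ≤ h x y u
weights-≤ g h ok x y u =
  ≤ᵇ⇒≤ _ _ (everyEdgeType-sound (λ x y u → g x y u ≤ᵇ h x y u) ok x y u)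

regions-⇒ : (f g : Region → Bool) → T (everyRegion λ x → not (f x) ∨ g x) →
            ∀ x → f x ≡ true → g x ≡ true
regions-⇒ f g ok x =
  implies (f x) (g x) (everyRegion-sound (λ x → not (f x) ∨ g x) ok x)
  where
  implies : ∀ a b → T (not a ∨ b) → a ≡ true → b ≡ true
  implies true true _ _ = refl

infixr 7 _∩ₑ_
infixr 6 _∪ₑ_
infixl 5 _─ₑ_

data SetExpr : Set where
  𝕏 𝕐 𝕎 : SetExpr
  _∩ₑ_ _∪ₑ_ _─ₑ_ : SetExpr → SetExpr → SetExpr
  ∁ₑ : SetExpr → SetExpr

⟦_⟧ : SetExpr → Region → Bool
⟦ 𝕏 ⟧      (a , b , c) = a
⟦ 𝕐 ⟧      (a , b , c) = b
⟦ 𝕎 ⟧      (a , b , c) = c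
⟦ s ∩ₑ t ⟧ x = ⟦ s ⟧ x ∧ ⟦ t ⟧ x
⟦ s ∪ₑ t ⟧ x = ⟦ s ⟧ x ∨ ⟦ t ⟧ x
⟦ s ─ₑ t ⟧ x = ⟦ s ⟧ x ∧ not (⟦ t ⟧ x)
⟦ ∁ₑ s ⟧   x = not (⟦ s ⟧ x)

Q₁ Q₂ Q₃ Q₄ : SetExpr
Q₁ = 𝕏 ∩ₑ 𝕐
Q₂ = 𝕏 ─ₑ 𝕐
Q₃ = 𝕐 ─ₑ 𝕏
Q₄ = ∁ₑ (𝕏 ∪ₑ 𝕐)

joins : (Region → Bool) → (Region → Bool) → Region → Region → Bool
joins f g x y = (f x ∧ g y) ∨ (g x ∧ f y)

cutʷ unsafeCutʷ : (Region → Bool) → EdgeWeight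
cutʷ       f x y u = 𝟙 (f x xor f y)
unsafeCutʷ f x y u = 𝟙 ((f x xor f y) ∧ u)

betweenʷ unsafeBetweenʷ : (Region → Bool) → (Region → Bool) → EdgeWeight
betweenʷ       f g x y u = 𝟙 (joins f g x y)
unsafeBetweenʷ f g x y u = 𝟙 (joins f g x y ∧ u)

commonʷ : (Region → Bool) → (Region → Bool) → (Region → Bool) → (Region → Bool) → EdgeWeight
commonʷ f g f′ g′ x y u = 𝟙 (joins f g x y ∧ joins f′ g′ x y)

touchesʷ : (Region → Bool) → EdgeWeight
touchesʷ f x y u = 𝟙 (f x ∨ f y)

unsafeCut∖cutʷ : (Region → Bool) → (Region → Bool) → EdgeWeight
unsafeCut∖cutʷ f g x y u = 𝟙 (((f x xor f y) ∧ u) ∧ not (g x xor g y))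

infixl 6 _⊕_

data Lin : Set where
  ⟨_⟩ : EdgeWeight → Lin
  _⊕_ : Lin → Lin → Lin

δ⟨_⟩ δᵘ⟨_⟩ : SetExpr → Lin
δ⟨ s ⟩  = ⟨ cutʷ ⟦ s ⟧ ⟩
δᵘ⟨ s ⟩ = ⟨ unsafeCutʷ ⟦ s ⟧ ⟩

E⟨_,_⟩ Eᵘ⟨_,_⟩ : SetExpr → SetExpr → Lin
E⟨ s , t ⟩  = ⟨ betweenʷ ⟦ s ⟧ ⟦ t ⟧ ⟩
Eᵘ⟨ s , t ⟩ = ⟨ unsafeBetweenʷ ⟦ s ⟧ ⟦ t ⟧ ⟩

⟦_⟧ʷ : Lin → EdgeWeight
⟦ ⟨ g ⟩ ⟧ʷ   = g
⟦ l ⊕ r ⟧ʷ x y u = ⟦ l ⟧ʷ x y u + ⟦ r ⟧ʷ x y u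

module Counting {n m : ℕ} (G : Graph n m) where
  open Graph G

  endˡ endʳ : Fin m → Fin n
  endˡ = proj₁ ∘ ends
  endʳ = proj₂ ∘ ends

  unsafeAt : Fin m → Bool
  unsafeAt = lookup unsafe

  lookup-δ : ∀ S e → lookup (δ G S) e ≡ (lookup S (endˡ e) xor lookup S (endʳ e))
  lookup-δ S = lookup∘tabulate _

  lookup-Eb : ∀ S T e → lookup (Eb G S T) e ≡
    ((lookup S (endˡ e) ∧ lookup T (endʳ e)) ∨ (lookup T (endˡ e) ∧ lookup S (endʳ e)))
  lookup-Eb S T = lookup∘tabulate _

  flex-cut : ∀ {p} → FlexConnected G p → ∀ S → Nonempty S → Nonempty (∁ S) →
             p + cap₂ ∣ δ G S ∩ unsafe ∣ ≤ ∣ δ G S ∣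
  flex-cut {p} flex S S≢∅ ∁S≢∅ = begin
    p + cap₂ ∣ D ∩ unsafe ∣  ≡⟨ cong (p +_) ∣F∣≡cap₂ ⟨
    p + ∣ F ∣                 ≤⟨ +-monoˡ-≤ ∣ F ∣ (flex F F⊆unsafe ∣F∣≤2 S S≢∅ ∁S≢∅) ⟩
    ∣ D ∩ ∁ F ∣ + ∣ F ∣       ≡⟨ ∣p∣≡∣p∩∁q∣+∣q∣ F⊆D ⟨
    ∣ D ∣                     ∎
    where
    open ≤-Reasoning
    D = δ G S
    F = takeTrue 2 (D ∩ unsafe)
    ∣F∣≡cap₂ : ∣ F ∣ ≡ cap₂ ∣ D ∩ unsafe ∣
    ∣F∣≡cap₂ = trans (∣takeTrue∣ 2 (D ∩ unsafe)) (⊓2≡cap₂ _)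
    ∣F∣≤2 : ∣ F ∣ ≤ 2
    ∣F∣≤2 = subst (_≤ 2) (sym ∣F∣≡cap₂) (cap₂≤2 _)
    F⊆unsafe : F ⊆ unsafe
    F⊆unsafe = proj₂ ∘ x∈p∩q⁻ D unsafe ∘ takeTrue-⊆ 2 (D ∩ unsafe)
    F⊆D : F ⊆ D
    F⊆D = proj₁ ∘ x∈p∩q⁻ D unsafe ∘ takeTrue-⊆ 2 (D ∩ unsafe)

  module Venn (X Y W : Subset n) where

    region : Fin n → Region
    region v = lookup X v , lookup Y v , lookup W v

    weightOf : EdgeWeight → Fin m → ℕ
    weightOf g e = g (region (endˡ e)) (region (endʳ e)) (unsafeAt e)

    count : EdgeWeight → ℕ
    count g = ∑ (weightOf g)

    d u : SetExpr → ℕ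
    d s = count (cutʷ ⟦ s ⟧)
    u s = count (unsafeCutʷ ⟦ s ⟧)

    e eᵘ : SetExpr → SetExpr → ℕ
    e  s t = count (betweenʷ ⟦ s ⟧ ⟦ t ⟧)
    eᵘ s t = count (unsafeBetweenʷ ⟦ s ⟧ ⟦ t ⟧)

    u≤d : ∀ s → u s ≤ d s
    u≤d s = ∑-mono-≤ λ e → 𝟙∧≤𝟙 (⟦ s ⟧ (region (endˡ e)) xor ⟦ s ⟧ (region (endʳ e))) (unsafeAt e)

    total : Lin → ℕ
    total ⟨ g ⟩   = count g
    total (l ⊕ r) = total l + total r

    count≡total : ∀ l → count ⟦ l ⟧ʷ ≡ total l
    count≡total ⟨ g ⟩   = refl
    count≡total (l ⊕ r) =
      trans (∑-distrib-+ (weightOf ⟦ l ⟧ʷ) (weightOf ⟦ r ⟧ʷ))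
            (cong₂ _+_ (count≡total l) (count≡total r))

    count-cong : (g h : EdgeWeight) → (∀ x y u → g x y u ≡ h x y u) → count g ≡ count h
    count-cong g h g≗h = ∑-cong λ e → g≗h (region (endˡ e)) (region (endʳ e)) (unsafeAt e)

    count-mono-≤ : (g h : EdgeWeight) → (∀ x y u → g x y u ≤ h x y u) → count g ≤ count h
    count-mono-≤ g h g≤h = ∑-mono-≤ λ e → g≤h (region (endˡ e)) (region (endʳ e)) (unsafeAt e)

    total-≡ : (l r : Lin) → T (everyEdgeType λ x y u → ⟦ l ⟧ʷ x y u ≡ᵇ ⟦ r ⟧ʷ x y u) →
              total l ≡ total r
    total-≡ l r ok = begin
      total l          ≡⟨ count≡total l ⟨
      count ⟦ l ⟧ʷ     ≡⟨ count-cong ⟦ l ⟧ʷ ⟦ r ⟧ʷ (weights-≡ ⟦ l ⟧ʷ ⟦ r ⟧ʷ ok) ⟩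
      count ⟦ r ⟧ʷ     ≡⟨ count≡total r ⟩
      total r          ∎
      where open ≡-Reasoning

    total-≤ : (l r : Lin) → T (everyEdgeType λ x y u → ⟦ l ⟧ʷ x y u ≤ᵇ ⟦ r ⟧ʷ x y u) →
              total l ≤ total r
    total-≤ l r ok = subst₂ _≤_ (count≡total l) (count≡total r)
      (count-mono-≤ ⟦ l ⟧ʷ ⟦ r ⟧ʷ (weights-≤ ⟦ l ⟧ʷ ⟦ r ⟧ʷ ok))

    count≡0 : (g : EdgeWeight) → (∀ e → weightOf g e ≡ 0) → count g ≡ 0
    count≡0 g zero-everywhere = trans (∑-cong zero-everywhere) (∑-zero m)

    ⟦_⟧ˢ : SetExpr → Subset n
    ⟦ 𝕏 ⟧ˢ      = X
    ⟦ 𝕐 ⟧ˢ      = Y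
    ⟦ 𝕎 ⟧ˢ      = W
    ⟦ s ∩ₑ t ⟧ˢ = ⟦ s ⟧ˢ ∩ ⟦ t ⟧ˢ
    ⟦ s ∪ₑ t ⟧ˢ = ⟦ s ⟧ˢ ∪ ⟦ t ⟧ˢ
    ⟦ s ─ₑ t ⟧ˢ = ⟦ s ⟧ˢ ─ ⟦ t ⟧ˢ
    ⟦ ∁ₑ s ⟧ˢ   = ∁ ⟦ s ⟧ˢ

    lookup-⟦⟧ˢ : ∀ s v → lookup ⟦ s ⟧ˢ v ≡ ⟦ s ⟧ (region v)
    lookup-⟦⟧ˢ 𝕏 v        = refl
    lookup-⟦⟧ˢ 𝕐 v        = refl
    lookup-⟦⟧ˢ 𝕎 v        = refl
    lookup-⟦⟧ˢ (s ∩ₑ t) v =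
      trans (lookup-zipWith _∧_ v ⟦ s ⟧ˢ ⟦ t ⟧ˢ) (cong₂ _∧_ (lookup-⟦⟧ˢ s v) (lookup-⟦⟧ˢ t v))
    lookup-⟦⟧ˢ (s ∪ₑ t) v =
      trans (lookup-zipWith _∨_ v ⟦ s ⟧ˢ ⟦ t ⟧ˢ) (cong₂ _∨_ (lookup-⟦⟧ˢ s v) (lookup-⟦⟧ˢ t v))
    lookup-⟦⟧ˢ (s ─ₑ t) v =
      trans (lookup-─ ⟦ s ⟧ˢ ⟦ t ⟧ˢ v) (cong₂ (λ a b → a ∧ not b) (lookup-⟦⟧ˢ s v) (lookup-⟦⟧ˢ t v))
    lookup-⟦⟧ˢ (∁ₑ s) v   = trans (lookup-map v not ⟦ s ⟧ˢ) (cong not (lookup-⟦⟧ˢ s v))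

    module _ (S : Subset n) (f : Region → Bool) (S≗f : ∀ v → lookup S v ≡ f (region v)) where

      lookup-δ-region : ∀ e → lookup (δ G S) e ≡ (f (region (endˡ e)) xor f (region (endʳ e)))
      lookup-δ-region e = trans (lookup-δ S e) (cong₂ _xor_ (S≗f (endˡ e)) (S≗f (endʳ e)))

      ∣δ∣≡count : ∣ δ G S ∣ ≡ count (cutʷ f)
      ∣δ∣≡count = trans (∣∣≡∑𝟙 (δ G S)) (∑-cong (cong 𝟙 ∘ lookup-δ-region))

      ∣δ∩unsafe∣≡count : ∣ δ G S ∩ unsafe ∣ ≡ count (unsafeCutʷ f)
      ∣δ∩unsafe∣≡count = trans (∣∣≡∑𝟙 (δ G S ∩ unsafe)) (∑-cong λ e → cong 𝟙
        (trans (lookup-zipWith _∧_ e (δ G S) unsafe) (cong (_∧ unsafeAt e) (lookup-δ-region e))))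

    lookup-Eb-region : ∀ s t e → lookup (Eb G ⟦ s ⟧ˢ ⟦ t ⟧ˢ) e ≡
                       joins ⟦ s ⟧ ⟦ t ⟧ (region (endˡ e)) (region (endʳ e))
    lookup-Eb-region s t e = trans (lookup-Eb ⟦ s ⟧ˢ ⟦ t ⟧ˢ e)
      (cong₂ _∨_ (cong₂ _∧_ (lookup-⟦⟧ˢ s (endˡ e)) (lookup-⟦⟧ˢ t (endʳ e)))
                 (cong₂ _∧_ (lookup-⟦⟧ˢ t (endˡ e)) (lookup-⟦⟧ˢ s (endʳ e))))

    ∣Eb∣≡e : ∀ s t → ∣ Eb G ⟦ s ⟧ˢ ⟦ t ⟧ˢ ∣ ≡ e s t
    ∣Eb∣≡e s t = trans (∣∣≡∑𝟙 (Eb G ⟦ s ⟧ˢ ⟦ t ⟧ˢ)) (∑-cong (cong 𝟙 ∘ lookup-Eb-region s t))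

    ∣Eb∩unsafe∣≡eᵘ : ∀ s t → ∣ Eb G ⟦ s ⟧ˢ ⟦ t ⟧ˢ ∩ unsafe ∣ ≡ eᵘ s t
    ∣Eb∩unsafe∣≡eᵘ s t = trans (∣∣≡∑𝟙 (Eb G ⟦ s ⟧ˢ ⟦ t ⟧ˢ ∩ unsafe)) (∑-cong λ e → cong 𝟙
      (trans (lookup-zipWith _∧_ e (Eb G ⟦ s ⟧ˢ ⟦ t ⟧ˢ) unsafe)
             (cong (_∧ unsafeAt e) (lookup-Eb-region s t e))))

    ∣Eb∣-≡ : ∀ s t s′ t′ → T (everyEdgeType λ x y u → betweenʷ ⟦ s ⟧ ⟦ t ⟧ x y u ≡ᵇ betweenʷ ⟦ s′ ⟧ ⟦ t′ ⟧ x y u) →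
             ∣ Eb G ⟦ s ⟧ˢ ⟦ t ⟧ˢ ∣ ≡ ∣ Eb G ⟦ s′ ⟧ˢ ⟦ t′ ⟧ˢ ∣
    ∣Eb∣-≡ s t s′ t′ ok =
      trans (∣Eb∣≡e s t) (trans (total-≡ E⟨ s , t ⟩ E⟨ s′ , t′ ⟩ ok) (sym (∣Eb∣≡e s′ t′)))

    ∣Eb∩unsafe∣-≡ : ∀ s t s′ t′ →
      T (everyEdgeType λ x y u → unsafeBetweenʷ ⟦ s ⟧ ⟦ t ⟧ x y u ≡ᵇ unsafeBetweenʷ ⟦ s′ ⟧ ⟦ t′ ⟧ x y u) →
      ∣ Eb G ⟦ s ⟧ˢ ⟦ t ⟧ˢ ∩ unsafe ∣ ≡ ∣ Eb G ⟦ s′ ⟧ˢ ⟦ t′ ⟧ˢ ∩ unsafe ∣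
    ∣Eb∩unsafe∣-≡ s t s′ t′ ok = trans (∣Eb∩unsafe∣≡eᵘ s t)
      (trans (total-≡ Eᵘ⟨ s , t ⟩ Eᵘ⟨ s′ , t′ ⟩ ok) (sym (∣Eb∩unsafe∣≡eᵘ s′ t′)))

    safe⇒eᵘ≡0 : ∀ s t → NoUnsafeEdge G (Eb G ⟦ s ⟧ˢ ⟦ t ⟧ˢ) → eᵘ s t ≡ 0
    safe⇒eᵘ≡0 s t safe = count≡0 (unsafeBetweenʷ ⟦ s ⟧ ⟦ t ⟧) λ e → 𝟙∧≡0 _ _ λ e∈E e∈U →
      safe e (lookup⇒∈ (trans (lookup-Eb-region s t e) e∈E)) (lookup⇒∈ e∈U)

    eᵘ≡0⇒safe : ∀ s t → eᵘ s t ≡ 0 → NoUnsafeEdge G (Eb G ⟦ s ⟧ˢ ⟦ t ⟧ˢ)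
    eᵘ≡0⇒safe s t none e e∈E e∈U = 1+n≢0 (trans (sym term≡1) term≡0)
      where
      term≡0 = ∑≡0⇒term≡0 (weightOf (unsafeBetweenʷ ⟦ s ⟧ ⟦ t ⟧)) none e
      term≡1 : weightOf (unsafeBetweenʷ ⟦ s ⟧ ⟦ t ⟧) e ≡ 1
      term≡1 = cong 𝟙 (cong₂ _∧_ (trans (sym (lookup-Eb-region s t e)) (∈⇒lookup e∈E)) (∈⇒lookup e∈U))

    nonempty⇒region : ∀ s → Nonempty ⟦ s ⟧ˢ → ∃ λ v → ⟦ s ⟧ (region v) ≡ true
    nonempty⇒region s (v , v∈) = v , trans (sym (lookup-⟦⟧ˢ s v)) (∈⇒lookup v∈)

    region⇒nonempty : ∀ s → (∃ λ v → ⟦ s ⟧ (region v) ≡ true) → Nonempty ⟦ s ⟧ˢ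
    region⇒nonempty s (v , v∈) = v , lookup⇒∈ (trans (lookup-⟦⟧ˢ s v) v∈)

    nonempty-mono : ∀ s t → T (everyRegion λ x → not (⟦ s ⟧ x) ∨ ⟦ t ⟧ x) →
                    Nonempty ⟦ s ⟧ˢ → Nonempty ⟦ t ⟧ˢ
    nonempty-mono s t s⊆t s≢∅ with nonempty⇒region s s≢∅
    ... | v , v∈s = region⇒nonempty t (v , regions-⇒ ⟦ s ⟧ ⟦ t ⟧ s⊆t (region v) v∈s)

    safe-mono : ∀ s t s′ t′ →
      T (everyEdgeType λ x y u → unsafeBetweenʷ ⟦ s′ ⟧ ⟦ t′ ⟧ x y u ≤ᵇ unsafeBetweenʷ ⟦ s ⟧ ⟦ t ⟧ x y u) →
      NoUnsafeEdge G (Eb G ⟦ s ⟧ˢ ⟦ t ⟧ˢ) → NoUnsafeEdge G (Eb G ⟦ s′ ⟧ˢ ⟦ t′ ⟧ˢ)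
    safe-mono s t s′ t′ ok none = eᵘ≡0⇒safe s′ t′ (n≤0⇒n≡0
      (subst (_ ≤_) (safe⇒eᵘ≡0 s t none)
        (total-≤ ⟨ unsafeBetweenʷ ⟦ s′ ⟧ ⟦ t′ ⟧ ⟩ ⟨ unsafeBetweenʷ ⟦ s ⟧ ⟦ t ⟧ ⟩ ok)))

    ⟦⟧ˢ-⊆ : ∀ s t → T (everyRegion λ x → not (⟦ s ⟧ x) ∨ ⟦ t ⟧ x) → ⟦ s ⟧ˢ ⊆ ⟦ t ⟧ˢ
    ⟦⟧ˢ-⊆ s t ok {v} v∈s = lookup⇒∈ (trans (lookup-⟦⟧ˢ t v)
      (regions-⇒ ⟦ s ⟧ ⟦ t ⟧ ok (region v) (trans (sym (lookup-⟦⟧ˢ s v)) (∈⇒lookup v∈s))))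

    ⟦⟧ˢ-≡-outside : ∀ r s t → ¬ Nonempty ⟦ r ⟧ˢ →
                    T (everyRegion λ x → ⟦ r ⟧ x ∨ not (⟦ s ⟧ x xor ⟦ t ⟧ x)) → ⟦ s ⟧ˢ ≡ ⟦ t ⟧ˢ
    ⟦⟧ˢ-≡-outside r s t empty ok = Subset-ext λ v → begin
      lookup ⟦ s ⟧ˢ v    ≡⟨ lookup-⟦⟧ˢ s v ⟩
      ⟦ s ⟧ (region v)   ≡⟨ agree (⟦ s ⟧ (region v)) (⟦ t ⟧ (region v)) (everyRegion-sound outside-or-agree ok (region v))
                                  (trans (sym (lookup-⟦⟧ˢ r v)) (¬Nonempty⇒lookup≡false ⟦ r ⟧ˢ empty v)) ⟩
      ⟦ t ⟧ (region v)   ≡⟨ lookup-⟦⟧ˢ t v ⟨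
      lookup ⟦ t ⟧ˢ v    ∎
      where
      open ≡-Reasoning
      outside-or-agree : Region → Bool
      outside-or-agree x = ⟦ r ⟧ x ∨ not (⟦ s ⟧ x xor ⟦ t ⟧ x)
      agree : ∀ a b {c} → T (c ∨ not (a xor b)) → c ≡ false → a ≡ b
      agree true  true  _ refl = refl
      agree false false _ refl = refl

    empty⇒count-touches≡0 : ∀ s → ¬ Nonempty ⟦ s ⟧ˢ → count (touchesʷ ⟦ s ⟧) ≡ 0
    empty⇒count-touches≡0 s empty = count≡0 (touchesʷ ⟦ s ⟧) λ e →
      cong 𝟙 (cong₂ _∨_ (outside (endˡ e)) (outside (endʳ e)))
      where
      outside : ∀ v → ⟦ s ⟧ (region v) ≡ false
      outside v = trans (sym (lookup-⟦⟧ˢ s v)) (¬Nonempty⇒lookup≡false ⟦ s ⟧ˢ empty v)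

    count≡0⇒unsafeCut⊆ : ∀ s t → count (unsafeCut∖cutʷ ⟦ s ⟧ ⟦ t ⟧) ≡ 0 →
                        ∀ {e} → e ∈ δ G ⟦ s ⟧ˢ → e ∈ unsafe → e ∈ δ G ⟦ t ⟧ˢ
    count≡0⇒unsafeCut⊆ s t none {e} e∈δs e∈U = lookup⇒∈ (trans (lookup-δ-region ⟦ t ⟧ˢ ⟦ t ⟧ (lookup-⟦⟧ˢ t) e)
      (forced (trans (sym (lookup-δ-region ⟦ s ⟧ˢ ⟦ s ⟧ (lookup-⟦⟧ˢ s) e)) (∈⇒lookup e∈δs)) (∈⇒lookup e∈U)
              (𝟙≡0⇒≡false (∑≡0⇒term≡0 (weightOf (unsafeCut∖cutʷ ⟦ s ⟧ ⟦ t ⟧)) none e))))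
      where
      forced : ∀ {a b c} → a ≡ true → b ≡ true → ((a ∧ b) ∧ not c) ≡ false → c ≡ true
      forced {c = true}  refl refl _  = refl
      forced {c = false} refl refl ()

    unsafeCut⊆⇒count≡0 : ∀ s t → (∀ {e} → e ∈ δ G ⟦ s ⟧ˢ → e ∈ unsafe → e ∈ δ G ⟦ t ⟧ˢ) →
                        count (unsafeCut∖cutʷ ⟦ s ⟧ ⟦ t ⟧) ≡ 0
    unsafeCut⊆⇒count≡0 s t δs⊆δt = count≡0 (unsafeCut∖cutʷ ⟦ s ⟧ ⟦ t ⟧) λ e →
      𝟙∧≡0 ((⟦ s ⟧ (region (endˡ e)) xor ⟦ s ⟧ (region (endʳ e))) ∧ unsafeAt e) _ λ cut-s∧unsafe uncut-t →
        let cut-s , e∈U = ∧≡true cut-s∧unsafe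
            e∈δt = δs⊆δt (lookup⇒∈ (trans (lookup-δ-region ⟦ s ⟧ˢ ⟦ s ⟧ (lookup-⟦⟧ˢ s) e) cut-s)) (lookup⇒∈ e∈U)
            cut-t = trans (sym (lookup-δ-region ⟦ t ⟧ˢ ⟦ t ⟧ (lookup-⟦⟧ˢ t) e)) (∈⇒lookup e∈δt)
        in contradiction (trans (sym cut-t) (not≡true uncut-t)) λ ()

    module _ {p : ℕ} where

      violated⇒counts : ∀ s → Violated G p ⟦ s ⟧ˢ → d s ≡ p + 2 × 3 ≤ u s
      violated⇒counts s (deg , unsafeDeg) =
        trans (sym (∣δ∣≡count ⟦ s ⟧ˢ ⟦ s ⟧ (lookup-⟦⟧ˢ s))) deg ,
        subst (3 ≤_) (∣δ∩unsafe∣≡count ⟦ s ⟧ˢ ⟦ s ⟧ (lookup-⟦⟧ˢ s)) unsafeDeg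

      counts⇒violated : ∀ s → d s ≡ p + 2 → 3 ≤ u s → Violated G p ⟦ s ⟧ˢ
      counts⇒violated s deg unsafeDeg =
        trans (∣δ∣≡count ⟦ s ⟧ˢ ⟦ s ⟧ (lookup-⟦⟧ˢ s)) deg ,
        subst (3 ≤_) (sym (∣δ∩unsafe∣≡count ⟦ s ⟧ˢ ⟦ s ⟧ (lookup-⟦⟧ˢ s))) unsafeDeg

      module _ (flex : FlexConnected G p) where

        flex-count : (f : Region → Bool) (v w : Fin n) → f (region v) ≡ true → f (region w) ≡ false →
                     p + cap₂ (count (unsafeCutʷ f)) ≤ count (cutʷ f)
        flex-count f v w fv fw =
          subst₂ (λ a b → p + cap₂ a ≤ b) (∣δ∩unsafe∣≡count S f S≗f) (∣δ∣≡count S f S≗f)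
                 (flex-cut flex S (v , lookup⇒∈ (trans (S≗f v) fv))
                                  (w , lookup⇒∈ (trans (lookup-map w not S) (cong not (trans (S≗f w) fw)))))
          where
          S : Subset n
          S = tabulate (f ∘ region)
          S≗f : ∀ v → lookup S v ≡ f (region v)
          S≗f = lookup∘tabulate (f ∘ region)

        flex-⟦⟧ : ∀ s → Nonempty ⟦ s ⟧ˢ → Nonempty ⟦ ∁ₑ s ⟧ˢ → p + cap₂ (u s) ≤ d s
        flex-⟦⟧ s s≢∅ ∁s≢∅ with nonempty⇒region s s≢∅ | nonempty⇒region (∁ₑ s) ∁s≢∅
        ... | v , v∈s | w , w∉s = flex-count ⟦ s ⟧ v w v∈s (not≡true w∉s)

        flex-cutʷ : (f : Region → Bool) → 1 ≤ count (cutʷ f) →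
                    p + cap₂ (count (unsafeCutʷ f)) ≤ count (cutʷ f)
        flex-cutʷ f cut≢0 with ∑-positive (weightOf (cutʷ f)) cut≢0
        ... | e , crossing with f (region (endˡ e)) in fˡ | f (region (endʳ e)) in fʳ
        ... | true  | false = flex-count f (endˡ e) (endʳ e) fˡ fʳ
        ... | false | true  = flex-count f (endʳ e) (endˡ e) fʳ fˡ

module AmenableSets {n m : ℕ} (G : Graph n m) (p : ℕ) where
  open Graph G
  open Counting G

  violated-∁ : ∀ {S} → Violated G p S → Violated G p (∁ S)
  violated-∁ {S} vS = counts⇒violated (∁ₑ 𝕏)
    (trans (total-≡ ⟨ cutʷ ⟦ ∁ₑ 𝕏 ⟧ ⟩ ⟨ cutʷ ⟦ 𝕏 ⟧ ⟩ tt) (proj₁ (violated⇒counts 𝕏 vS)))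
    (≤-trans (proj₂ (violated⇒counts 𝕏 vS)) (total-≤ ⟨ unsafeCutʷ ⟦ 𝕏 ⟧ ⟩ ⟨ unsafeCutʷ ⟦ ∁ₑ 𝕏 ⟧ ⟩ tt))
    where open Venn S S S

  module _ {A B : Subset n} where
    open Venn A B A

    cross-sym : Cross G A B → Cross G B A
    cross-sym (A─B , A∩B , B─A , ∁A∪B) =
      B─A , nonempty-mono (𝕏 ∩ₑ 𝕐) (𝕐 ∩ₑ 𝕏) tt A∩B , A─B , nonempty-mono (∁ₑ (𝕏 ∪ₑ 𝕐)) (∁ₑ (𝕐 ∪ₑ 𝕏)) tt ∁A∪B

    cross-∁ʳ : Cross G A B → Cross G A (∁ B)
    cross-∁ʳ (A─B , A∩B , B─A , ∁A∪B) =
      nonempty-mono (𝕏 ∩ₑ 𝕐) (𝕏 ─ₑ ∁ₑ 𝕐) tt A∩B , nonempty-mono (𝕏 ─ₑ 𝕐) (𝕏 ∩ₑ ∁ₑ 𝕐) tt A─B ,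
      nonempty-mono (∁ₑ (𝕏 ∪ₑ 𝕐)) (∁ₑ 𝕐 ─ₑ 𝕏) tt ∁A∪B , nonempty-mono (𝕐 ─ₑ 𝕏) (∁ₑ (𝕏 ∪ₑ ∁ₑ 𝕐)) tt B─A

    cross-∁ˡ⁻¹ : Cross G (∁ A) B → Cross G A B
    cross-∁ˡ⁻¹ (∁A─B , ∁A∩B , B─∁A , ∁∁A∪B) =
      nonempty-mono (∁ₑ (∁ₑ 𝕏 ∪ₑ 𝕐)) (𝕏 ─ₑ 𝕐) tt ∁∁A∪B , nonempty-mono (𝕐 ─ₑ ∁ₑ 𝕏) (𝕏 ∩ₑ 𝕐) tt B─∁A ,
      nonempty-mono (∁ₑ 𝕏 ∩ₑ 𝕐) (𝕐 ─ₑ 𝕏) tt ∁A∩B , nonempty-mono (∁ₑ 𝕏 ─ₑ 𝕐) (∁ₑ (𝕏 ∪ₑ 𝕐)) tt ∁A─B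

  AmenableEdges : Subset n → Subset n → Set
  AmenableEdges A B = NoUnsafeEdge G (Eb G (A ∩ B) (B ─ A)) ⊎ NoUnsafeEdge G (Eb G (A ─ B) (∁ (A ∪ B)))

  amenableEdges-∁ˡ : ∀ {A B} → AmenableEdges A B → AmenableEdges (∁ A) B
  amenableEdges-∁ˡ {A} {B} (inj₁ none) =
    inj₁ (safe-mono (𝕏 ∩ₑ 𝕐) (𝕐 ─ₑ 𝕏) (∁ₑ 𝕏 ∩ₑ 𝕐) (𝕐 ─ₑ ∁ₑ 𝕏) tt none)
    where open Venn A B A
  amenableEdges-∁ˡ {A} {B} (inj₂ none) =
    inj₂ (safe-mono (𝕏 ─ₑ 𝕐) (∁ₑ (𝕏 ∪ₑ 𝕐)) (∁ₑ 𝕏 ─ₑ 𝕐) (∁ₑ (∁ₑ 𝕏 ∪ₑ 𝕐)) tt none)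
    where open Venn A B A

  safe₂₄⇒safe₁₃-∁ : ∀ {A B} → NoUnsafeEdge G (Eb G (A ─ B) (∁ (A ∪ B))) →
                           NoUnsafeEdge G (Eb G (A ∩ ∁ B) (∁ B ─ A))
  safe₂₄⇒safe₁₃-∁ {A} {B} = safe-mono Q₂ Q₄ (𝕏 ∩ₑ ∁ₑ 𝕐) (∁ₑ 𝕐 ─ₑ 𝕏) tt
    where open Venn A B A

  Amenable : Subset n → Set
  Amenable A = Violated G p A × (∀ D → Violated G p D → Cross G A D → AmenablyCross G A D)

  amenable-∁ : ∀ {A} → Amenable A → Amenable (∁ A)
  amenable-∁ {A} (vA , amenableA) = violated-∁ {A} vA , λ D vD ∁AD →
    ∁AD , amenableEdges-∁ˡ {B = D} (proj₂ (amenableA D vD (cross-∁ˡ⁻¹ ∁AD)))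

  amenable-∁⁻¹ : ∀ {A} → Amenable (∁ A) → Amenable A
  amenable-∁⁻¹ {A} = subst Amenable (∁-involutive A) ∘ amenable-∁

  violated? : ∀ S → Dec (Violated G p S)
  violated? S = (∣ δ G S ∣ ≟ p + 2) ×-dec (3 ≤? ∣ δ G S ∩ unsafe ∣)

  cross? : ∀ A B → Dec (Cross G A B)
  cross? A B = nonempty? (A ─ B) ×-dec nonempty? (A ∩ B) ×-dec nonempty? (B ─ A) ×-dec nonempty? (∁ (A ∪ B))

  amenable⇒F₁ : ∀ {A} → Amenable A → F₁ G p A
  amenable⇒F₁ {A} (vA , amenableA) with anySubset? (λ D → violated? D ×-dec cross? A D)
  ... | yes (D , vD , AD) = vA , inj₂ (D , vD , amenableA D vD AD)
  ... | no ∄D             = vA , inj₁ (λ D vD AD → ∄D (D , vD , AD))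

  amenable-⊆ : ∀ {Y Z} → Violated G p Y → Amenable Z → Y ⊆ Z →
               (∀ {e} → e ∈ δ G Y → e ∈ unsafe → e ∈ δ G Z) → Amenable Y
  amenable-⊆ {Y} {Z} vY (_ , amenableZ) Y⊆Z δY⊆δZ = vY , λ D vD YD → YD , edges D vD YD
    where
    module Edges (D : Subset n) where
      open Venn Y Z D public

      Y─Z-empty : ¬ Nonempty ⟦ 𝕏 ─ₑ 𝕐 ⟧ˢ
      Y─Z-empty (v , v∈Y─Z) with ∧≡true (trans (sym (lookup-─ Y Z v)) (∈⇒lookup v∈Y─Z))
      ... | v∈Y , v∉Z = contradiction (trans (sym (∈⇒lookup (Y⊆Z (lookup⇒∈ v∈Y)))) (not≡true v∉Z)) λ ()

      safe-via : ∀ s t (g : EdgeWeight) → count g ≡ 0 →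
        T (everyEdgeType λ x y u → ⟦ ⟨ unsafeBetweenʷ ⟦ s ⟧ ⟦ t ⟧ ⟩ ⟧ʷ x y u ≤ᵇ
             ⟦ ⟨ unsafeCut∖cutʷ ⟦ 𝕏 ⟧ ⟦ 𝕐 ⟧ ⟩ ⊕ ⟨ g ⟩ ⊕ ⟨ touchesʷ ⟦ 𝕏 ─ₑ 𝕐 ⟧ ⟩ ⟧ʷ x y u) →
        NoUnsafeEdge G (Eb G ⟦ s ⟧ˢ ⟦ t ⟧ˢ)
      safe-via s t g g≡0 ok = eᵘ≡0⇒safe s t (n≤0⇒n≡0 (begin
        count (unsafeBetweenʷ ⟦ s ⟧ ⟦ t ⟧)
          ≤⟨ total-≤ Eᵘ⟨ s , t ⟩ (⟨ unsafeCut∖cutʷ ⟦ 𝕏 ⟧ ⟦ 𝕐 ⟧ ⟩ ⊕ ⟨ g ⟩ ⊕ ⟨ touchesʷ ⟦ 𝕏 ─ₑ 𝕐 ⟧ ⟩) ok ⟩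
        count (unsafeCut∖cutʷ ⟦ 𝕏 ⟧ ⟦ 𝕐 ⟧) + count g + count (touchesʷ ⟦ 𝕏 ─ₑ 𝕐 ⟧)
          ≡⟨ cong₂ _+_ (cong₂ _+_ (unsafeCut⊆⇒count≡0 𝕏 𝕐 δY⊆δZ) g≡0) (empty⇒count-touches≡0 (𝕏 ─ₑ 𝕐) Y─Z-empty) ⟩
        0 ∎))
        where open ≤-Reasoning

    edges : ∀ D → Violated G p D → Cross G Y D → AmenableEdges Y D
    edges D vD YD with cross? Z D
    ... | yes ZD with proj₂ (amenableZ D vD ZD)
    ...   | inj₁ safe = inj₁ (safe-via (𝕏 ∩ₑ 𝕎) (𝕎 ─ₑ 𝕏) (unsafeBetweenʷ ⟦ 𝕐 ∩ₑ 𝕎 ⟧ ⟦ 𝕎 ─ₑ 𝕐 ⟧)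
                                      (safe⇒eᵘ≡0 (𝕐 ∩ₑ 𝕎) (𝕎 ─ₑ 𝕐) safe) tt)
      where open Edges D
    ...   | inj₂ safe = inj₂ (safe-via (𝕏 ─ₑ 𝕎) (∁ₑ (𝕏 ∪ₑ 𝕎)) (unsafeBetweenʷ ⟦ 𝕐 ─ₑ 𝕎 ⟧ ⟦ ∁ₑ (𝕐 ∪ₑ 𝕎) ⟧)
                                      (safe⇒eᵘ≡0 (𝕐 ─ₑ 𝕎) (∁ₑ (𝕐 ∪ₑ 𝕎)) safe) tt)
      where open Edges D
    edges D vD YD | no ¬ZD with nonempty? (D ─ Z) | nonempty? (∁ (Z ∪ D))
    ... | no D─Z≡∅ | _ = inj₁ (safe-via (𝕏 ∩ₑ 𝕎) (𝕎 ─ₑ 𝕏) (touchesʷ ⟦ 𝕎 ─ₑ 𝕐 ⟧)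
                                        (empty⇒count-touches≡0 (𝕎 ─ₑ 𝕐) D─Z≡∅) tt)
      where open Edges D
    ... | yes _ | no ∁Z∪D≡∅ = inj₂ (safe-via (𝕏 ─ₑ 𝕎) (∁ₑ (𝕏 ∪ₑ 𝕎)) (touchesʷ ⟦ ∁ₑ (𝕐 ∪ₑ 𝕎) ⟧)
                                             (empty⇒count-touches≡0 (∁ₑ (𝕐 ∪ₑ 𝕎)) ∁Z∪D≡∅) tt)
      where open Edges D
    ... | yes D─Z | yes ∁Z∪D = contradiction (Z─D , Z∩D , D─Z , ∁Z∪D) ¬ZD
      where
      Z─D : Nonempty (Z ─ D)
      Z─D = proj₁ (proj₁ YD) , ─-monoˡ D Y⊆Z (proj₂ (proj₁ YD))
      Z∩D : Nonempty (Z ∩ D)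
      Z∩D = proj₁ (proj₁ (proj₂ YD)) , ∩-monoˡ D Y⊆Z (proj₂ (proj₁ (proj₂ YD)))

module CrossingViolatedSets {n m : ℕ} (G : Graph n m) (k : ℕ) (p≥3 : 3 ≤ suc (k + k))
                    (flex : FlexConnected G (suc (k + k))) where
  open Graph G
  open Counting G

  p : ℕ
  p = suc (k + k)

  open AmenableSets G p

  module ViolatedPair {X Y : Subset n} (vX : Violated G p X) (vY : Violated G p Y) (XY : Cross G X Y) where
    open Venn X Y X public

    d𝕏 : d 𝕏 ≡ p + 2
    d𝕏 = proj₁ (violated⇒counts {p} 𝕏 vX)
    d𝕐 : d 𝕐 ≡ p + 2
    d𝕐 = proj₁ (violated⇒counts {p} 𝕐 vY)
    u𝕏 : 3 ≤ u 𝕏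
    u𝕏 = proj₂ (violated⇒counts {p} 𝕏 vX)
    u𝕐 : 3 ≤ u 𝕐
    u𝕐 = proj₂ (violated⇒counts {p} 𝕐 vY)

    Q₁≢∅ : Nonempty ⟦ Q₁ ⟧ˢ
    Q₁≢∅ = proj₁ (proj₂ XY)
    Q₂≢∅ : Nonempty ⟦ Q₂ ⟧ˢ
    Q₂≢∅ = proj₁ XY
    Q₃≢∅ : Nonempty ⟦ Q₃ ⟧ˢ
    Q₃≢∅ = proj₁ (proj₂ (proj₂ XY))
    Q₄≢∅ : Nonempty ⟦ Q₄ ⟧ˢ
    Q₄≢∅ = proj₂ (proj₂ (proj₂ XY))

    flex₁ : p + cap₂ (u Q₁) ≤ d Q₁
    flex₁ = flex-⟦⟧ flex Q₁ Q₁≢∅ (nonempty-mono Q₂ (∁ₑ Q₁) tt Q₂≢∅)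
    flex₂ : p + cap₂ (u Q₂) ≤ d Q₂
    flex₂ = flex-⟦⟧ flex Q₂ Q₂≢∅ (nonempty-mono Q₁ (∁ₑ Q₂) tt Q₁≢∅)
    flex₃ : p + cap₂ (u Q₃) ≤ d Q₃
    flex₃ = flex-⟦⟧ flex Q₃ Q₃≢∅ (nonempty-mono Q₁ (∁ₑ Q₃) tt Q₁≢∅)
    flex₄ : p + cap₂ (u Q₄) ≤ d Q₄
    flex₄ = flex-⟦⟧ flex Q₄ Q₄≢∅ (nonempty-mono Q₁ (∁ₑ Q₄) tt Q₁≢∅)

    sum₁₄ : d Q₁ + d Q₄ + (e Q₂ Q₃ + e Q₂ Q₃) ≡ (p + 2) + (p + 2)
    sum₁₄ = trans (total-≡ (δ⟨ Q₁ ⟩ ⊕ δ⟨ Q₄ ⟩ ⊕ (E⟨ Q₂ , Q₃ ⟩ ⊕ E⟨ Q₂ , Q₃ ⟩)) (δ⟨ 𝕏 ⟩ ⊕ δ⟨ 𝕐 ⟩) tt)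
                  (cong₂ _+_ d𝕏 d𝕐)

    sum₂₃ : d Q₂ + d Q₃ + (e Q₁ Q₄ + e Q₁ Q₄) ≡ (p + 2) + (p + 2)
    sum₂₃ = trans (total-≡ (δ⟨ Q₂ ⟩ ⊕ δ⟨ Q₃ ⟩ ⊕ (E⟨ Q₁ , Q₄ ⟩ ⊕ E⟨ Q₁ , Q₄ ⟩)) (δ⟨ 𝕏 ⟩ ⊕ δ⟨ 𝕐 ⟩) tt)
                  (cong₂ _+_ d𝕏 d𝕐)

    unsafe-sum₁₄ : u Q₁ + u Q₄ + (eᵘ Q₂ Q₃ + eᵘ Q₂ Q₃) ≡ u 𝕏 + u 𝕐
    unsafe-sum₁₄ = total-≡ (δᵘ⟨ Q₁ ⟩ ⊕ δᵘ⟨ Q₄ ⟩ ⊕ (Eᵘ⟨ Q₂ , Q₃ ⟩ ⊕ Eᵘ⟨ Q₂ , Q₃ ⟩)) (δᵘ⟨ 𝕏 ⟩ ⊕ δᵘ⟨ 𝕐 ⟩) tt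

    sum₁₂ : d Q₁ + d Q₂ ≡ (p + 2) + (e Q₁ Q₂ + e Q₁ Q₂)
    sum₁₂ = trans (total-≡ (δ⟨ Q₁ ⟩ ⊕ δ⟨ Q₂ ⟩) (δ⟨ 𝕏 ⟩ ⊕ (E⟨ Q₁ , Q₂ ⟩ ⊕ E⟨ Q₁ , Q₂ ⟩)) tt)
                  (cong (_+ (e Q₁ Q₂ + e Q₁ Q₂)) d𝕏)

    sum₁₃ : d Q₁ + d Q₃ ≡ (p + 2) + (e Q₁ Q₃ + e Q₁ Q₃)
    sum₁₃ = trans (total-≡ (δ⟨ Q₁ ⟩ ⊕ δ⟨ Q₃ ⟩) (δ⟨ 𝕐 ⟩ ⊕ (E⟨ Q₁ , Q₃ ⟩ ⊕ E⟨ Q₁ , Q₃ ⟩)) tt)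
                  (cong (_+ (e Q₁ Q₃ + e Q₁ Q₃)) d𝕐)

    flex-≥ : ∀ s → p + cap₂ (u s) ≤ d s → 3 ≤ u s → p + 2 ≤ d s
    flex-≥ s flex-s u≥3 = subst (λ c → p + c ≤ d s) (cap₂≡2 (≤-trans (s≤s (s≤s z≤n)) u≥3)) flex-s

    d₁-even : 3 ≤ u Q₂ → 3 ≤ u Q₃ → d Q₁ ≡ e Q₁ Q₂ + e Q₁ Q₂
    d₁-even u₂≥3 u₃≥3 = +-cancelʳ-≡ (p + 2) _ _ (begin
      d Q₁ + (p + 2)              ≡⟨ cong (d Q₁ +_) d₂≡p+2 ⟨
      d Q₁ + d Q₂                 ≡⟨ sum₁₂ ⟩
      (p + 2) + (e Q₁ Q₂ + e Q₁ Q₂) ≡⟨ +-comm (p + 2) _ ⟩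
      e Q₁ Q₂ + e Q₁ Q₂ + (p + 2) ∎)
      where
      open ≡-Reasoning
      d₂≡p+2 : d Q₂ ≡ p + 2
      d₂≡p+2 = proj₁ (squeeze (p + 2) {c = e Q₁ Q₄} sum₂₃ (flex-≥ Q₂ flex₂ u₂≥3) (flex-≥ Q₃ flex₃ u₃≥3))

    -- A diagonal edge leaves room for unsafe edges on only one of Q₁, Q₄; then Q₂ and Q₃
    -- are tight and d(Q₁) = 2 e(Q₁, Q₂), although d(Q₁) is p or p + 2.
    diagonal-absurd : 1 ≤ e Q₂ Q₃ → ⊥
    diagonal-absurd E≥1 with diagonal-cases p E≥1 sum₁₄ flex₁ flex₄ eᵘ≤e six
      where
      eᵘ≤e = total-≤ Eᵘ⟨ Q₂ , Q₃ ⟩ E⟨ Q₂ , Q₃ ⟩ tt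
      six = subst (6 ≤_) (sym unsafe-sum₁₄) (+-mono-≤ u𝕏 u𝕐)
    ... | inj₁ (u₄≡0 , d₁≡p+2) = odd≢even (suc k) (e Q₁ Q₂) (begin
      suc (suc k + suc k)   ≡⟨ odd+2 k ⟨
      p + 2                 ≡⟨ d₁≡p+2 ⟨
      d Q₁                  ≡⟨ d₁-even u₂≥3 u₃≥3 ⟩
      e Q₁ Q₂ + e Q₁ Q₂     ∎)
      where
      open ≡-Reasoning
      odd+2 : ∀ k → suc (k + k) + 2 ≡ suc (suc k + suc k)
      odd+2 = solve-∀
      u₂≥3 = ≤-trans u𝕐 $ ≤-drop-zero (total-≤ δᵘ⟨ 𝕐 ⟩ (δᵘ⟨ Q₂ ⟩ ⊕ δᵘ⟨ Q₄ ⟩) tt) u₄≡0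
      u₃≥3 = ≤-trans u𝕏 $ ≤-drop-zero (total-≤ δᵘ⟨ 𝕏 ⟩ (δᵘ⟨ Q₃ ⟩ ⊕ δᵘ⟨ Q₄ ⟩) tt) u₄≡0
    ... | inj₂ (u₁≡0 , d₁≡p) = odd≢even k (e Q₁ Q₂) (trans (sym d₁≡p) (d₁-even u₂≥3 u₃≥3))
      where
      u₂≥3 = ≤-trans u𝕏 $ ≤-drop-zero (total-≤ δᵘ⟨ 𝕏 ⟩ (δᵘ⟨ Q₂ ⟩ ⊕ δᵘ⟨ Q₁ ⟩) tt) u₁≡0
      u₃≥3 = ≤-trans u𝕐 $ ≤-drop-zero (total-≤ δᵘ⟨ 𝕐 ⟩ (δᵘ⟨ Q₃ ⟩ ⊕ δᵘ⟨ Q₁ ⟩) tt) u₁≡0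

    no-diagonal : ∣ Eb G (X ─ Y) (Y ─ X) ∣ ≡ 0
    no-diagonal = trans (∣Eb∣≡e Q₂ Q₃) (n≤0⇒n≡0 (≮⇒≥ diagonal-absurd))

    link : suc k ≤ ∣ Eb G (X ∩ Y) (Y ─ X) ∣
    link = subst (suc k ≤_) (sym (∣Eb∣≡e Q₁ Q₃))
      (link-lower-bound k 1 sum₁₃ flex₁ flex₃
        (cap₂-pair {u Q₁} {u Q₃} (≤-trans u𝕐 (total-≤ δᵘ⟨ 𝕐 ⟩ (δᵘ⟨ Q₁ ⟩ ⊕ δᵘ⟨ Q₃ ⟩) tt))))

    link-unsafe : 2 ≤ ∣ Eb G (X ∩ Y) (Y ─ X) ∩ unsafe ∣ → 2 + k ≤ ∣ Eb G (X ∩ Y) (Y ─ X) ∣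
    link-unsafe two = subst (2 + k ≤_) (sym (∣Eb∣≡e Q₁ Q₃))
      (link-lower-bound k 2 sum₁₃ flex₁ flex₃ (+-mono-≤ (cap₂≥2 δᵘ⟨ Q₁ ⟩ tt) (cap₂≥2 δᵘ⟨ Q₃ ⟩ tt)))
      where
      two′ : 2 ≤ eᵘ Q₁ Q₃
      two′ = subst (2 ≤_) (∣Eb∩unsafe∣≡eᵘ Q₁ Q₃) two
      cap₂≥2 : ∀ l → T (everyEdgeType λ x y u → ⟦ Eᵘ⟨ Q₁ , Q₃ ⟩ ⟧ʷ x y u ≤ᵇ ⟦ l ⟧ʷ x y u) → 2 ≤ cap₂ (total l)
      cap₂≥2 l ok = ≤-reflexive (sym (cap₂≡2 (≤-trans two′ (total-≤ Eᵘ⟨ Q₁ , Q₃ ⟩ l ok))))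

  -- The quadrants Q₁, Q₂, Q₃, Q₄ of (X, ∁ Y) are Q₂, Q₁, Q₄, Q₃ of (X, Y).
  module _ {X Y : Subset n} (vX : Violated G p X) (vY : Violated G p Y) (XY : Cross G X Y) where
    private
      module Pair  = ViolatedPair vX vY XY
      module Pair∁ = ViolatedPair vX (violated-∁ {Y} vY) (cross-∁ʳ {X} {Y} XY)
      open Venn X Y X

    no-diagonal₂₃ : ∣ Eb G (X ─ Y) (Y ─ X) ∣ ≡ 0
    no-diagonal₂₃ = Pair.no-diagonal

    no-diagonal₁₄ : ∣ Eb G (X ∩ Y) (∁ (X ∪ Y)) ∣ ≡ 0
    no-diagonal₁₄ = trans (∣Eb∣-≡ Q₁ Q₄ (𝕏 ─ₑ ∁ₑ 𝕐) (∁ₑ 𝕐 ─ₑ 𝕏) tt) Pair∁.no-diagonal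

    link₁₃ : suc k ≤ ∣ Eb G (X ∩ Y) (Y ─ X) ∣
    link₁₃ = Pair.link

    link₁₃-unsafe : 2 ≤ ∣ Eb G (X ∩ Y) (Y ─ X) ∩ unsafe ∣ → 2 + k ≤ ∣ Eb G (X ∩ Y) (Y ─ X) ∣
    link₁₃-unsafe = Pair.link-unsafe

    link₂₄ : suc k ≤ ∣ Eb G (X ─ Y) (∁ (X ∪ Y)) ∣
    link₂₄ = subst (suc k ≤_) (∣Eb∣-≡ (𝕏 ∩ₑ ∁ₑ 𝕐) (∁ₑ 𝕐 ─ₑ 𝕏) Q₂ Q₄ tt) Pair∁.link

    link₂₄-unsafe : 2 ≤ ∣ Eb G (X ─ Y) (∁ (X ∪ Y)) ∩ unsafe ∣ → 2 + k ≤ ∣ Eb G (X ─ Y) (∁ (X ∪ Y)) ∣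
    link₂₄-unsafe two = subst (2 + k ≤_) (∣Eb∣-≡ (𝕏 ∩ₑ ∁ₑ 𝕐) (∁ₑ 𝕐 ─ₑ 𝕏) Q₂ Q₄ tt)
      (Pair∁.link-unsafe (subst (2 ≤_) (∣Eb∩unsafe∣-≡ Q₂ Q₄ (𝕏 ∩ₑ ∁ₑ 𝕐) (∁ₑ 𝕐 ─ₑ 𝕏) tt) two))

  module Propagation {A B C : Subset n} (vA : Violated G p A) (vB : Violated G p B) (vC : Violated G p C)
                     (AB : Cross G A B) (AC : Cross G A C) (safeAC : NoUnsafeEdge G (Eb G (A ∩ C) (C ─ A))) where
    open Venn A B C

    K₁ K₂ : SetExpr
    K₁ = 𝕏 ∩ₑ 𝕎
    K₂ = 𝕎 ─ₑ 𝕏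

    h₁ h₂ x y K : ℕ
    h₁ = e Q₁ Q₃
    h₂ = e Q₂ Q₄
    x  = eᵘ Q₁ Q₃
    y  = eᵘ Q₂ Q₄
    K  = e K₁ K₂

    diag₂₃ᴮ : e Q₂ Q₃ ≡ 0
    diag₂₃ᴮ = trans (sym (∣Eb∣≡e Q₂ Q₃)) (no-diagonal₂₃ vA vB AB)
    diag₁₄ᴮ : e Q₁ Q₄ ≡ 0
    diag₁₄ᴮ = trans (sym (∣Eb∣≡e Q₁ Q₄)) (no-diagonal₁₄ vA vB AB)
    diag₂₃ᶜ : e (𝕏 ─ₑ 𝕎) (𝕎 ─ₑ 𝕏) ≡ 0
    diag₂₃ᶜ = trans (sym (∣Eb∣≡e (𝕏 ─ₑ 𝕎) (𝕎 ─ₑ 𝕏))) (no-diagonal₂₃ vA vC AC)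
    diag₁₄ᶜ : e (𝕏 ∩ₑ 𝕎) (∁ₑ (𝕏 ∪ₑ 𝕎)) ≡ 0
    diag₁₄ᶜ = trans (sym (∣Eb∣≡e (𝕏 ∩ₑ 𝕎) (∁ₑ (𝕏 ∪ₑ 𝕎)))) (no-diagonal₁₄ vA vC AC)
    safeK : eᵘ K₁ K₂ ≡ 0
    safeK = safe⇒eᵘ≡0 K₁ K₂ safeAC

    h₁+h₂ : h₁ + h₂ ≡ p + 2
    h₁+h₂ = begin
      h₁ + h₂                          ≡⟨ +-identityʳ _ ⟨
      h₁ + h₂ + 0                      ≡⟨ cong (h₁ + h₂ +_) (cong₂ _+_ diag₂₃ᴮ diag₁₄ᴮ) ⟨
      h₁ + h₂ + (e Q₂ Q₃ + e Q₁ Q₄)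
        ≡⟨ total-≡ (E⟨ Q₁ , Q₃ ⟩ ⊕ E⟨ Q₂ , Q₄ ⟩ ⊕ (E⟨ Q₂ , Q₃ ⟩ ⊕ E⟨ Q₁ , Q₄ ⟩)) δ⟨ 𝕏 ⟩ tt ⟩
      d 𝕏                              ≡⟨ proj₁ (violated⇒counts {p} 𝕏 vA) ⟩
      p + 2                            ∎
      where open ≡-Reasoning

    x+y≥3 : 3 ≤ x + y
    x+y≥3 = ≤-trans (proj₂ (violated⇒counts {p} 𝕏 vA)) (≤-drop-zero
      (total-≤ δᵘ⟨ 𝕏 ⟩ (Eᵘ⟨ Q₁ , Q₃ ⟩ ⊕ Eᵘ⟨ Q₂ , Q₄ ⟩ ⊕ (E⟨ Q₂ , Q₃ ⟩ ⊕ E⟨ Q₁ , Q₄ ⟩)) tt)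
      (cong₂ _+_ diag₂₃ᴮ diag₁₄ᴮ))

    K≥ : suc k ≤ K
    K≥ = subst (suc k ≤_) (∣Eb∣≡e K₁ K₂) (link₁₃ vA vC AC)
    h₁≥ : suc k ≤ h₁
    h₁≥ = subst (suc k ≤_) (∣Eb∣≡e Q₁ Q₃) (link₁₃ vA vB AB)
    h₂≥ : suc k ≤ h₂
    h₂≥ = subst (suc k ≤_) (∣Eb∣≡e Q₂ Q₄) (link₂₄ vA vB AB)
    h₁≥-unsafe : 2 ≤ x → 2 + k ≤ h₁
    h₁≥-unsafe x≥2 = subst (2 + k ≤_) (∣Eb∣≡e Q₁ Q₃)
      (link₁₃-unsafe vA vB AB (subst (2 ≤_) (sym (∣Eb∩unsafe∣≡eᵘ Q₁ Q₃)) x≥2))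
    h₂≥-unsafe : 2 ≤ y → 2 + k ≤ h₂
    h₂≥-unsafe y≥2 = subst (2 + k ≤_) (∣Eb∣≡e Q₂ Q₄)
      (link₂₄-unsafe vA vB AB (subst (2 ≤_) (sym (∣Eb∩unsafe∣≡eᵘ Q₂ Q₄)) y≥2))

    O₁ O₂ : Lin
    O₁ = ⟨ commonʷ ⟦ K₁ ⟧ ⟦ K₂ ⟧ ⟦ Q₁ ⟧ ⟦ Q₃ ⟧ ⟩
    O₂ = ⟨ commonʷ ⟦ K₁ ⟧ ⟦ K₂ ⟧ ⟦ Q₂ ⟧ ⟦ Q₄ ⟧ ⟩

    o₁ o₂ : ℕ
    o₁ = total O₁
    o₂ = total O₂

    zero₄ : ∀ {a b c d} → a ≡ 0 → b ≡ 0 → c ≡ 0 → d ≡ 0 → a + b + c + d ≡ 0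
    zero₄ refl refl refl refl = refl

    K+x≤h₁ : o₂ ≡ 0 → K + x ≤ h₁
    K+x≤h₁ o₂≡0 = ≤-drop-zero
      (total-≤ (E⟨ K₁ , K₂ ⟩ ⊕ Eᵘ⟨ Q₁ , Q₃ ⟩)
               (E⟨ Q₁ , Q₃ ⟩ ⊕ (O₂ ⊕ E⟨ Q₂ , Q₃ ⟩ ⊕ E⟨ Q₁ , Q₄ ⟩ ⊕ Eᵘ⟨ K₁ , K₂ ⟩)) tt)
      (zero₄ o₂≡0 diag₂₃ᴮ diag₁₄ᴮ safeK)

    K+y≤h₂ : o₁ ≡ 0 → K + y ≤ h₂
    K+y≤h₂ o₁≡0 = ≤-drop-zero
      (total-≤ (E⟨ K₁ , K₂ ⟩ ⊕ Eᵘ⟨ Q₂ , Q₄ ⟩)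
               (E⟨ Q₂ , Q₄ ⟩ ⊕ (O₁ ⊕ E⟨ Q₂ , Q₃ ⟩ ⊕ E⟨ Q₁ , Q₄ ⟩ ⊕ Eᵘ⟨ K₁ , K₂ ⟩)) tt)
      (zero₄ o₁≡0 diag₂₃ᴮ diag₁₄ᴮ safeK)

    a₁₁₀ a₀₁₀ a₁₀₀ a₀₀₀ a₁₁₁ a₀₁₁ a₁₀₁ a₀₀₁ : SetExpr
    a₁₁₀ = 𝕏 ∩ₑ 𝕐 ─ₑ 𝕎
    a₀₁₀ = 𝕐 ─ₑ (𝕏 ∪ₑ 𝕎)
    a₁₀₀ = 𝕏 ─ₑ (𝕐 ∪ₑ 𝕎)
    a₀₀₀ = ∁ₑ (𝕏 ∪ₑ 𝕐 ∪ₑ 𝕎)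
    a₁₁₁ = 𝕏 ∩ₑ 𝕐 ∩ₑ 𝕎
    a₀₁₁ = 𝕐 ∩ₑ 𝕎 ─ₑ 𝕏
    a₁₀₁ = 𝕏 ∩ₑ 𝕎 ─ₑ 𝕐
    a₀₀₁ = 𝕎 ─ₑ (𝕏 ∪ₑ 𝕐)

    flex-atom : ∀ s → 1 ≤ d s → p + cap₂ (u s) ≤ d s
    flex-atom s = flex-cutʷ flex ⟦ s ⟧

    emptyᶜ : Lin
    emptyᶜ = Eᵘ⟨ K₁ , K₂ ⟩ ⊕ E⟨ 𝕏 ∩ₑ 𝕎 , ∁ₑ (𝕏 ∪ₑ 𝕎) ⟩ ⊕ E⟨ 𝕏 ─ₑ 𝕎 , 𝕎 ─ₑ 𝕏 ⟩

    unsafe-link≤u : ∀ l s → T (everyEdgeType λ a b v → ⟦ l ⟧ʷ a b v ≤ᵇ ⟦ δᵘ⟨ s ⟩ ⊕ emptyᶜ ⟧ʷ a b v) →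
                    total l ≤ u s
    unsafe-link≤u l s ok = ≤-drop-zero (total-≤ l (δᵘ⟨ s ⟩ ⊕ emptyᶜ) ok)
      (cong₂ _+_ (cong₂ _+_ safeK diag₁₄ᶜ) diag₂₃ᶜ)

    atoms-outside-C : 1 ≤ x → 1 ≤ y → 4 * p + 6 ≤ d a₁₁₀ + d a₀₁₀ + d a₁₀₀ + d a₀₀₀
    atoms-outside-C x≥1 y≥1 =
      ≤-trans (+-monoʳ-≤ (4 * p) (cap₂-sum₄-six x≥1 y≥1 x+y≥3 x≤u₁₁₀ x≤u₀₁₀ y≤u₁₀₀ y≤u₀₀₀))
              (flex-sum₄ p (via-unsafe a₁₁₀ x≥1 x≤u₁₁₀) (via-unsafe a₀₁₀ x≥1 x≤u₀₁₀)
                           (via-unsafe a₁₀₀ y≥1 y≤u₁₀₀) (via-unsafe a₀₀₀ y≥1 y≤u₀₀₀))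
      where
      x≤u₁₁₀ = unsafe-link≤u Eᵘ⟨ Q₁ , Q₃ ⟩ a₁₁₀ tt
      x≤u₀₁₀ = unsafe-link≤u Eᵘ⟨ Q₁ , Q₃ ⟩ a₀₁₀ tt
      y≤u₁₀₀ = unsafe-link≤u Eᵘ⟨ Q₂ , Q₄ ⟩ a₁₀₀ tt
      y≤u₀₀₀ = unsafe-link≤u Eᵘ⟨ Q₂ , Q₄ ⟩ a₀₀₀ tt
      via-unsafe : ∀ {j} s → 1 ≤ j → j ≤ u s → p + cap₂ (u s) ≤ d s
      via-unsafe s j≥1 j≤u = flex-atom s (≤-trans j≥1 (≤-trans j≤u (u≤d s)))

    atoms-inside-C : 1 ≤ o₁ → 1 ≤ o₂ → 4 * p + 1 ≤ d a₁₁₁ + d a₀₁₁ + d a₁₀₁ + d a₀₀₁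
    atoms-inside-C o₁≥1 o₂≥1 =
      ≤-trans (+-monoʳ-≤ (4 * p) (cap₂-sum₄ (u a₁₁₁) (u a₀₁₁) (u a₁₀₁) (u a₀₀₁)
                (≤-trans (≤-trans (s≤s z≤n) (proj₂ (violated⇒counts {p} 𝕎 vC)))
                         (total-≤ δᵘ⟨ 𝕎 ⟩ (δᵘ⟨ a₁₁₁ ⟩ ⊕ δᵘ⟨ a₀₁₁ ⟩ ⊕ δᵘ⟨ a₁₀₁ ⟩ ⊕ δᵘ⟨ a₀₀₁ ⟩) tt))))
              (flex-sum₄ p (via-overlap a₁₁₁ o₁≥1 (total-≤ O₁ δ⟨ a₁₁₁ ⟩ tt))
                           (via-overlap a₀₁₁ o₁≥1 (total-≤ O₁ δ⟨ a₀₁₁ ⟩ tt))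
                           (via-overlap a₁₀₁ o₂≥1 (total-≤ O₂ δ⟨ a₁₀₁ ⟩ tt))
                           (via-overlap a₀₀₁ o₂≥1 (total-≤ O₂ δ⟨ a₀₀₁ ⟩ tt)))
      where
      via-overlap : ∀ {j} s → 1 ≤ j → j ≤ d s → p + cap₂ (u s) ≤ d s
      via-overlap s j≥1 j≤d = flex-atom s (≤-trans j≥1 j≤d)

    atoms-total : d a₁₁₀ + d a₀₁₀ + d a₁₀₀ + d a₀₀₀ + (d a₁₁₁ + d a₀₁₁ + d a₁₀₁ + d a₀₀₁) ≤ 6 * (p + 2)
    atoms-total = begin
      d a₁₁₀ + d a₀₁₀ + d a₁₀₀ + d a₀₀₀ + (d a₁₁₁ + d a₀₁₁ + d a₁₀₁ + d a₀₀₁)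
        ≤⟨ total-≤ (δ⟨ a₁₁₀ ⟩ ⊕ δ⟨ a₀₁₀ ⟩ ⊕ δ⟨ a₁₀₀ ⟩ ⊕ δ⟨ a₀₀₀ ⟩ ⊕
                    (δ⟨ a₁₁₁ ⟩ ⊕ δ⟨ a₀₁₁ ⟩ ⊕ δ⟨ a₁₀₁ ⟩ ⊕ δ⟨ a₀₀₁ ⟩))
                   (δ⟨ 𝕏 ⟩ ⊕ δ⟨ 𝕐 ⟩ ⊕ δ⟨ 𝕎 ⟩ ⊕ (δ⟨ 𝕏 ⟩ ⊕ δ⟨ 𝕐 ⟩ ⊕ δ⟨ 𝕎 ⟩)) tt ⟩
      d 𝕏 + d 𝕐 + d 𝕎 + (d 𝕏 + d 𝕐 + d 𝕎)
        ≡⟨ cong (λ t → t + t) (cong₂ _+_ (cong₂ _+_ (proj₁ (violated⇒counts {p} 𝕏 vA))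
                                                   (proj₁ (violated⇒counts {p} 𝕐 vB)))
                                         (proj₁ (violated⇒counts {p} 𝕎 vC))) ⟩
      (p + 2) + (p + 2) + (p + 2) + ((p + 2) + (p + 2) + (p + 2))
        ≡⟨ six-times (p + 2) ⟩
      6 * (p + 2) ∎
      where
      open ≤-Reasoning
      six-times : ∀ q → q + q + q + (q + q + q) ≡ 6 * q
      six-times = solve-∀

    both-unsafe : 1 ≤ x → 1 ≤ y → ⊥
    both-unsafe x≥1 y≥1 with o₂ ≟ 0 | o₁ ≟ 0
    ... | yes o₂≡0 | _ = link-split-absurd k h₁+h₂ K≥ (K+x≤h₁ o₂≡0) x≥1 h₂≥ x+y≥3 h₂≥-unsafe
    ... | no _ | yes o₁≡0 = link-split-absurd k (trans (+-comm h₂ h₁) h₁+h₂) K≥ (K+y≤h₂ o₁≡0) y≥1 h₁≥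
                                             (subst (3 ≤_) (+-comm x y) x+y≥3) h₁≥-unsafe
    ... | no o₂≢0 | no o₁≢0 = cube-absurd p p≥3 (atoms-outside-C x≥1 y≥1)
                                (atoms-inside-C (n≢0⇒n>0 o₁≢0) (n≢0⇒n>0 o₂≢0)) atoms-total

    amenable-edges : AmenableEdges A B
    amenable-edges with x ≟ 0 | y ≟ 0
    ... | yes x≡0 | _       = inj₁ (eᵘ≡0⇒safe Q₁ Q₃ x≡0)
    ... | no _    | yes y≡0 = inj₂ (eᵘ≡0⇒safe Q₂ Q₄ y≡0)
    ... | no x≢0  | no y≢0  = ⊥-elim (both-unsafe (n≢0⇒n>0 x≢0) (n≢0⇒n>0 y≢0))

  amenablyCross-propagates : ∀ {A B C} → Violated G p A → Violated G p B → Violated G p C →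
    Cross G A B → AmenablyCross G A C → AmenablyCross G A B
  amenablyCross-propagates vA vB vC AB (AC , inj₁ safe) = AB , Propagation.amenable-edges vA vB vC AB AC safe
  amenablyCross-propagates {A} {C = C} vA vB vC AB (AC , inj₂ safe) =
    AB , Propagation.amenable-edges vA vB (violated-∁ {C} vC) AB (cross-∁ʳ {A} {C} AC)
                                    (safe₂₄⇒safe₁₃-∁ {A} {C} safe)

  F₁⇒amenable : ∀ {A} → F₁ G p A → Amenable A
  F₁⇒amenable (vA , inj₁ crosses-none)    = vA , λ D vD AD → contradiction AD (crosses-none D vD)
  F₁⇒amenable (vA , inj₂ (C , vC , AC)) = vA , λ D vD AD → amenablyCross-propagates vA vD vC AD AC

  module Uncrossing {A B : Subset n} (amA : Amenable A) (amB : Amenable B) (AB : Cross G A B) where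
    open ViolatedPair (proj₁ amA) (proj₁ amB) AB

    diag₂₃ : e Q₂ Q₃ ≡ 0
    diag₂₃ = trans (sym (∣Eb∣≡e Q₂ Q₃)) (no-diagonal₂₃ (proj₁ amA) (proj₁ amB) AB)
    diag₁₄ : e Q₁ Q₄ ≡ 0
    diag₁₄ = trans (sym (∣Eb∣≡e Q₁ Q₄)) (no-diagonal₁₄ (proj₁ amA) (proj₁ amB) AB)

    unsafe≥3 : ∀ l (z : Lin) → 3 ≤ total l → total z ≡ 0 → ∀ s →
      T (everyEdgeType λ a b v → ⟦ l ⟧ʷ a b v ≤ᵇ ⟦ δᵘ⟨ s ⟩ ⊕ z ⟧ʷ a b v) → 3 ≤ u s
    unsafe≥3 l z l≥3 z≡0 s ok = ≤-trans l≥3 (≤-drop-zero (total-≤ l (δᵘ⟨ s ⟩ ⊕ z) ok) z≡0)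

    violated₂₃ : 3 ≤ u Q₂ → 3 ≤ u Q₃ → Violated G p (A ─ B) × Violated G p (B ─ A)
    violated₂₃ u₂≥3 u₃≥3 with squeeze (p + 2) {c = e Q₁ Q₄} sum₂₃ (flex-≥ Q₂ flex₂ u₂≥3) (flex-≥ Q₃ flex₃ u₃≥3)
    ... | d₂≡ , d₃≡ = counts⇒violated {p} Q₂ d₂≡ u₂≥3 , counts⇒violated {p} Q₃ d₃≡ u₃≥3

    violated₁₄ : 3 ≤ u Q₁ → 3 ≤ u Q₄ → Violated G p (A ∩ B) × Violated G p (∁ (A ∪ B))
    violated₁₄ u₁≥3 u₄≥3 with squeeze (p + 2) {c = e Q₂ Q₃} sum₁₄ (flex-≥ Q₁ flex₁ u₁≥3) (flex-≥ Q₄ flex₄ u₄≥3)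
    ... | d₁≡ , d₄≡ = counts⇒violated {p} Q₁ d₁≡ u₁≥3 , counts⇒violated {p} Q₄ d₄≡ u₄≥3

    amenable-quadrant : ∀ s t → Violated G p ⟦ s ⟧ˢ → Amenable ⟦ t ⟧ˢ →
      T (everyRegion λ x → not (⟦ s ⟧ x) ∨ ⟦ t ⟧ x) →
      ∀ s′ t′ → eᵘ s′ t′ ≡ 0 →
      T (everyEdgeType λ a b v → unsafeCut∖cutʷ ⟦ s ⟧ ⟦ t ⟧ a b v ≤ᵇ unsafeBetweenʷ ⟦ s′ ⟧ ⟦ t′ ⟧ a b v) →
      Amenable ⟦ s ⟧ˢ
    amenable-quadrant s t vs amt s⊆t s′ t′ safe ok = amenable-⊆ vs amt (⟦⟧ˢ-⊆ s t s⊆t)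
      (count≡0⇒unsafeCut⊆ s t (n≤0⇒n≡0 (subst (_ ≤_) safe
        (total-≤ ⟨ unsafeCut∖cutʷ ⟦ s ⟧ ⟦ t ⟧ ⟩ Eᵘ⟨ s′ , t′ ⟩ ok))))

    zero₂ : ∀ {a b} → a ≡ 0 → b ≡ 0 → a + b ≡ 0
    zero₂ refl refl = refl

    uncrossed : (F₁ G p (A ∪ B) × F₁ G p (A ∩ B)) ⊎ (F₁ G p (A ─ B) × F₁ G p (B ─ A))
    uncrossed with proj₂ (proj₂ amA B (proj₁ amB) AB) | proj₂ (proj₂ amB A (proj₁ amA) (cross-sym AB))
    ... | inj₁ safe₁₃ | inj₁ safe₁₂ =
      inj₂ (amenable⇒F₁ (amenable-quadrant Q₂ 𝕏 (proj₁ v₂₃) amA tt (𝕐 ∩ₑ 𝕏) Q₂ z₁₂ tt) ,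
            amenable⇒F₁ (amenable-quadrant Q₃ 𝕐 (proj₂ v₂₃) amB tt Q₁ Q₃ z₁₃ tt))
      where
      z₁₃ = safe⇒eᵘ≡0 Q₁ Q₃ safe₁₃
      z₁₂ = safe⇒eᵘ≡0 (𝕐 ∩ₑ 𝕏) Q₂ safe₁₂
      v₂₃ = violated₂₃ (unsafe≥3 δᵘ⟨ 𝕏 ⟩ (Eᵘ⟨ Q₁ , Q₃ ⟩ ⊕ E⟨ Q₁ , Q₄ ⟩) u𝕏 (zero₂ z₁₃ diag₁₄) Q₂ tt)
                       (unsafe≥3 δᵘ⟨ 𝕐 ⟩ (Eᵘ⟨ 𝕐 ∩ₑ 𝕏 , Q₂ ⟩ ⊕ E⟨ Q₁ , Q₄ ⟩) u𝕐 (zero₂ z₁₂ diag₁₄) Q₃ tt)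
    ... | inj₁ safe₁₃ | inj₂ safe₃₄ =
      inj₁ (amenable⇒F₁ (amenable-∁⁻¹ (amenable-quadrant Q₄ (∁ₑ 𝕏) (proj₂ v₁₄) (amenable-∁ amA) tt Q₃ (∁ₑ (𝕐 ∪ₑ 𝕏)) z₃₄ tt)) ,
            amenable⇒F₁ (amenable-quadrant Q₁ 𝕐 (proj₁ v₁₄) amB tt Q₁ Q₃ z₁₃ tt))
      where
      z₁₃ = safe⇒eᵘ≡0 Q₁ Q₃ safe₁₃
      z₃₄ = safe⇒eᵘ≡0 Q₃ (∁ₑ (𝕐 ∪ₑ 𝕏)) safe₃₄
      v₁₄ = violated₁₄ (unsafe≥3 δᵘ⟨ 𝕐 ⟩ (Eᵘ⟨ Q₃ , ∁ₑ (𝕐 ∪ₑ 𝕏) ⟩ ⊕ E⟨ Q₂ , Q₃ ⟩) u𝕐 (zero₂ z₃₄ diag₂₃) Q₁ tt)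
                       (unsafe≥3 δᵘ⟨ 𝕏 ⟩ (Eᵘ⟨ Q₁ , Q₃ ⟩ ⊕ E⟨ Q₂ , Q₃ ⟩) u𝕏 (zero₂ z₁₃ diag₂₃) Q₄ tt)
    ... | inj₂ safe₂₄ | inj₁ safe₁₂ =
      inj₁ (amenable⇒F₁ (amenable-∁⁻¹ (amenable-quadrant Q₄ (∁ₑ 𝕐) (proj₂ v₁₄) (amenable-∁ amB) tt Q₂ Q₄ z₂₄ tt)) ,
            amenable⇒F₁ (amenable-quadrant Q₁ 𝕏 (proj₁ v₁₄) amA tt (𝕐 ∩ₑ 𝕏) Q₂ z₁₂ tt))
      where
      z₂₄ = safe⇒eᵘ≡0 Q₂ Q₄ safe₂₄
      z₁₂ = safe⇒eᵘ≡0 (𝕐 ∩ₑ 𝕏) Q₂ safe₁₂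
      v₁₄ = violated₁₄ (unsafe≥3 δᵘ⟨ 𝕏 ⟩ (Eᵘ⟨ Q₂ , Q₄ ⟩ ⊕ E⟨ Q₂ , Q₃ ⟩) u𝕏 (zero₂ z₂₄ diag₂₃) Q₁ tt)
                       (unsafe≥3 δᵘ⟨ 𝕐 ⟩ (Eᵘ⟨ 𝕐 ∩ₑ 𝕏 , Q₂ ⟩ ⊕ E⟨ Q₂ , Q₃ ⟩) u𝕐 (zero₂ z₁₂ diag₂₃) Q₄ tt)
    ... | inj₂ safe₂₄ | inj₂ safe₃₄ =
      inj₂ (amenable⇒F₁ (amenable-quadrant Q₂ (∁ₑ 𝕐) (proj₁ v₂₃) (amenable-∁ amB) tt Q₂ Q₄ z₂₄ tt) ,
            amenable⇒F₁ (amenable-quadrant Q₃ (∁ₑ 𝕏) (proj₂ v₂₃) (amenable-∁ amA) tt Q₃ (∁ₑ (𝕐 ∪ₑ 𝕏)) z₃₄ tt))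
      where
      z₂₄ = safe⇒eᵘ≡0 Q₂ Q₄ safe₂₄
      z₃₄ = safe⇒eᵘ≡0 Q₃ (∁ₑ (𝕐 ∪ₑ 𝕏)) safe₃₄
      v₂₃ = violated₂₃ (unsafe≥3 δᵘ⟨ 𝕐 ⟩ (Eᵘ⟨ Q₃ , ∁ₑ (𝕐 ∪ₑ 𝕏) ⟩ ⊕ E⟨ Q₁ , Q₄ ⟩) u𝕐 (zero₂ z₃₄ diag₁₄) Q₂ tt)
                       (unsafe≥3 δᵘ⟨ 𝕏 ⟩ (Eᵘ⟨ Q₂ , Q₄ ⟩ ⊕ E⟨ Q₁ , Q₄ ⟩) u𝕏 (zero₂ z₂₄ diag₁₄) Q₃ tt)

  F₁-uncrossable : Uncrossable (F₁ G p)
  F₁-uncrossable A B FA FB with cross? A B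
  ... | yes AB = Uncrossing.uncrossed (F₁⇒amenable FA) (F₁⇒amenable FB) AB
  ... | no ¬AB with nonempty? (A ─ B) | nonempty? (A ∩ B) | nonempty? (B ─ A) | nonempty? (∁ (A ∪ B))
  ...   | no A─B≡∅ | _ | _ | _ =
    inj₁ (subst (F₁ G p) (sym (⟦⟧ˢ-≡-outside Q₂ (𝕏 ∪ₑ 𝕐) 𝕐 A─B≡∅ tt)) FB ,
          subst (F₁ G p) (sym (⟦⟧ˢ-≡-outside Q₂ Q₁ 𝕏 A─B≡∅ tt)) FA)
    where open Venn A B A
  ...   | yes _ | no A∩B≡∅ | _ | _ =
    inj₂ (subst (F₁ G p) (sym (⟦⟧ˢ-≡-outside Q₁ Q₂ 𝕏 A∩B≡∅ tt)) FA ,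
          subst (F₁ G p) (sym (⟦⟧ˢ-≡-outside Q₁ Q₃ 𝕐 A∩B≡∅ tt)) FB)
    where open Venn A B A
  ...   | yes _ | yes _ | no B─A≡∅ | _ =
    inj₁ (subst (F₁ G p) (sym (⟦⟧ˢ-≡-outside Q₃ (𝕏 ∪ₑ 𝕐) 𝕏 B─A≡∅ tt)) FA ,
          subst (F₁ G p) (sym (⟦⟧ˢ-≡-outside Q₃ Q₁ 𝕐 B─A≡∅ tt)) FB)
    where open Venn A B A
  ...   | yes _ | yes _ | yes _ | no ∁A∪B≡∅ =
    inj₂ (subst (F₁ G p) (sym (⟦⟧ˢ-≡-outside Q₄ Q₂ (∁ₑ 𝕐) ∁A∪B≡∅ tt)) (∁-F₁ FB) ,
          subst (F₁ G p) (sym (⟦⟧ˢ-≡-outside Q₄ Q₃ (∁ₑ 𝕏) ∁A∪B≡∅ tt)) (∁-F₁ FA))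
    where
    open Venn A B A
    ∁-F₁ : ∀ {S} → F₁ G p S → F₁ G p (∁ S)
    ∁-F₁ = amenable⇒F₁ ∘ amenable-∁ ∘ F₁⇒amenable
  ...   | yes A─B | yes A∩B | yes B─A | yes ∁A∪B = contradiction (A─B , A∩B , B─A , ∁A∪B) ¬AB

lemma6 : {n m : ℕ} (G : Graph n m) (p : ℕ) → 3 ≤ p → p % 2 ≡ 1 →
    FlexConnected G p → Uncrossable (F₁ G p)
lemma6 G p p≥3 p-odd = subst (λ q → FlexConnected G q → Uncrossable (F₁ G q)) (sym p≡2k+1)
  λ flex → CrossingViolatedSets.F₁-uncrossable G (p / 2) (subst (3 ≤_) p≡2k+1 p≥3) flex
  where
  p≡2k+1 : p ≡ suc (p / 2 + p / 2)
  p≡2k+1 = trans (m≡m%n+[m/n]*n p 2) (cong₂ _+_ p-odd (double (p / 2)))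
    where
    double : ∀ k → k * 2 ≡ k + k
    double = solve-∀
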